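{- Let $L$ be an Eulerian binomial poset which is furthermore a lattice. Then $L$ is isomorphic to the Boolean algebra $\mathbb{B}_X$, where $X$ is the set of atoms of $L$.
   Context: All posets are locally finite with a unique minimal element $\hat 0$. A binomial poset is such a poset $P$ that contains an infinite chain, has every interval $[x,y]$ graded (rank function $\rho$; $[x,y]$ is an $n$-interval if $\rho(y)-\rho(x)=n$), and for every $n$ any two $n$-intervals have the same number $B(n)$ of maximal chains. A poset is Eulerian if $\mu(x,y)=(-1)^{\rho(y)-\rho(x)}$ for all $x\le y$. For a set $X$, $\mathbb{B}_X$ denotes the poset of all finite subsets of $X$ ordered by inclusion. -}

module Defs where

open import Level using (Level; _⊔_)
open import Data.Nat using (ℕ; zero; suc; _+_; _∸_)
open import Data.Integer as ℤ using (ℤ; 0ℤ; 1ℤ; -1ℤ)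
open import Data.List using (List; []; _∷_; length; map; foldr)
open import Data.List.Relation.Unary.All using (All)
open import Data.List.Relation.Unary.Any using (Any)
open import Data.List.Relation.Unary.AllPairs using (AllPairs)
open import Data.List.Relation.Binary.Pointwise using (Pointwise)
open import Data.Product using (Σ; ∃; ∃-syntax; _×_; proj₁)
open import Data.Empty using (⊥)
open import Relation.Nullary using (¬_)
open import Relation.Binary using (Rel)
open import Relation.Binary.Bundles using (Poset)
open import Relation.Binary.PropositionalEquality using (_≡_)
open import Relation.Binary.Lattice.Definitions using (Supremum; Infimum)
open import Relation.Binary.Morphism.Structures using (IsOrderIsomorphism)

sumℤ : List ℤ → ℤ
sumℤ = foldr ℤ._+_ 0ℤ

-- Cardinality of a "set" given as a predicate S on a setoid-like type (A, _~_):
-- there is a duplicate-free (up to ~) list of exactly k elements of S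
-- containing (up to ~) every element of S.
HasCard : ∀ {a ℓ s} {A : Set a} → Rel A ℓ → (A → Set s) → ℕ → Set (a ⊔ ℓ ⊔ s)
HasCard _~_ S k =
  ∃[ l ] (length l ≡ k × All S l × AllPairs (λ u v → ¬ (u ~ v)) l
          × (∀ u → S u → Any (u ~_) l))

module PosetNotions {c ℓ₁ ℓ₂ : Level} (P : Poset c ℓ₁ ℓ₂) where
  open Poset P using (Carrier; _≈_; _≤_)

  _<_ : Carrier → Carrier → Set (ℓ₁ ⊔ ℓ₂)
  x < y = x ≤ y × ¬ (x ≈ y)

  _⋖_ : Carrier → Carrier → Set (c ⊔ ℓ₁ ⊔ ℓ₂)
  x ⋖ y = x < y × ¬ (∃[ z ] (x < z × z < y))

  IsBottom : Carrier → Set (c ⊔ ℓ₂)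
  IsBottom z = ∀ x → z ≤ x

  IsIntervalEnum : Carrier → Carrier → List Carrier → Set (c ⊔ ℓ₁ ⊔ ℓ₂)
  IsIntervalEnum x y l =
    All (λ z → x ≤ z × z ≤ y) l
    × (∀ z → x ≤ z → z ≤ y → Any (z ≈_) l)
    × AllPairs (λ u v → ¬ (u ≈ v)) l

  LocallyFinite : Set (c ⊔ ℓ₁ ⊔ ℓ₂)
  LocallyFinite = ∀ x y → ∃[ l ] IsIntervalEnum x y l

  IsRankFunction : Carrier → (Carrier → ℕ) → Set (c ⊔ ℓ₁ ⊔ ℓ₂)
  IsRankFunction z ρ =
    ρ z ≡ 0
    × (∀ x y → x ≈ y → ρ x ≡ ρ y)
    × (∀ x y → x ⋖ y → ρ y ≡ suc (ρ x))

  HasInfiniteChain : Set (c ⊔ ℓ₁ ⊔ ℓ₂)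
  HasInfiniteChain = Σ (ℕ → Carrier) λ f → (∀ (n : ℕ) → f n < f (suc n))

  CoverPath : Carrier → Carrier → List Carrier → Set (c ⊔ ℓ₁ ⊔ ℓ₂)
  CoverPath z y []       = Level.Lift (c ⊔ ℓ₂) (z ≈ y)
  CoverPath z y (w ∷ ws) = z ⋖ w × CoverPath w y ws

  IsMaximalChain : Carrier → Carrier → List Carrier → Set (c ⊔ ℓ₁ ⊔ ℓ₂)
  IsMaximalChain x y []       = Level.Lift (c ⊔ ℓ₁ ⊔ ℓ₂) ⊥
  IsMaximalChain x y (z ∷ zs) = x ≈ z × CoverPath z y zs

  IsBinomial : (Carrier → ℕ) → Set (c ⊔ ℓ₁ ⊔ ℓ₂)
  IsBinomial ρ =
    HasInfiniteChain
    × Σ (ℕ → ℕ) λ B → (∀ (n : ℕ) x y → x ≤ y → ρ y ≡ ρ x + n →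
                HasCard (Pointwise _≈_) (IsMaximalChain x y) (B n))

  IsMöbiusFunction : (Carrier → Carrier → ℤ) → Set (c ⊔ ℓ₁ ⊔ ℓ₂)
  IsMöbiusFunction m =
    (∀ x → m x x ≡ 1ℤ)
    × (∀ x y → x < y → ∀ l → IsIntervalEnum x y l → sumℤ (map (m x) l) ≡ 0ℤ)

  IsEulerian : (Carrier → ℕ) → Set (c ⊔ ℓ₁ ⊔ ℓ₂)
  IsEulerian ρ = IsMöbiusFunction (λ x y → -1ℤ ℤ.^ (ρ y ∸ ρ x))

  IsLattice : Set (c ⊔ ℓ₂)
  IsLattice = ∃[ _∨_ ] ∃[ _∧_ ] (Supremum _≤_ _∨_ × Infimum _≤_ _∧_)

  Atom : Carrier → Set (c ⊔ ℓ₁ ⊔ ℓ₂)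
  Atom z = Σ Carrier (z ⋖_)

  -- 𝔹_X for X the set of atoms: finite subsets of X, represented by lists,
  -- ordered by inclusion; equality = equality as sets
  FinSubset : Carrier → Set (c ⊔ ℓ₁ ⊔ ℓ₂)
  FinSubset z = List (Atom z)

  _⊆B_ : ∀ {z} → FinSubset z → FinSubset z → Set (c ⊔ ℓ₁ ⊔ ℓ₂)
  S ⊆B T = All (λ a → Any (λ b → proj₁ a ≈ proj₁ b) T) S

  _≈B_ : ∀ {z} → FinSubset z → FinSubset z → Set (c ⊔ ℓ₁ ⊔ ℓ₂)
  S ≈B T = S ⊆B T × T ⊆B S

  IsoToBooleanOfAtoms : Carrier → Set (c ⊔ ℓ₁ ⊔ ℓ₂)
  IsoToBooleanOfAtoms z =
    ∃[ f ] IsOrderIsomorphism _≈_ (_≈B_ {z}) _≤_ (_⊆B_ {z}) f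

-- In a binomial poset every n-interval has the same number A n of atoms: counting the maximal
-- chains of an (m + 1)-interval by their first atom gives B (m + 1) = A (m + 1) · B m. Double counting
-- pairs (atom, element of rank i) shows that an n-interval has F n / (F i · F (n - i)) elements of
-- rank i, where F n = A 1 ⋯ A n, and the Eulerian relation at length 2 gives A 2 = 2.
-- In a lattice with A 2 = 2, each atom e of [a, y], for a an atom of [x, y], is a ∨ o for exactly one
-- other atom o of [x, e]; so e ↦ o injects the atoms of [a, y] into those of [x, y] other than a, and
-- A (m + 1) ≥ A m + 1 ≥ m + 1. If A k = k for k ≤ p with p even, the Eulerian relation at length
-- p + 2 becomes (p + 2) + A (p + 2) A (p + 1) = (p + 2) A (p + 2), which together with A (p + 1) ≥ p + 1
-- forces A (p + 1) = p + 1 and A (p + 2) = p + 2. Once A n = n the injection is onto: the join of two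
-- atoms over x covers each of them, hence x ⋖ x ∨ a for every atom a ≰ x, every element is the join of
-- the atoms below it, and x ↦ {atoms below x} is an isomorphism onto the finite sets of atoms.

module Submission where

open import Defs
open import Level using (Level)
open import Data.Nat using (ℕ)
open import Relation.Binary.Bundles using (Poset)
open import Relation.Binary using (Setoid)
open import Relation.Nullary using (Dec)

module IntegerSums where

  open import Data.Nat as ℕ using (zero; suc; _<_)
  import Data.Nat.Properties as ℕ
  open import Data.Nat.Combinatorics using (_C_; nCk+nC[k+1]≡[n+1]C[k+1]; k>n⇒nCk≡0)
  open import Data.Integer as ℤ using (ℤ; +_; 0ℤ; 1ℤ; -1ℤ; _+_; _*_; _-_; _^_)
  import Data.Integer.Properties as ℤ
  open import Data.Integer.Tactic.RingSolver using (solve-∀)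
  open import Data.Sum using (inj₁; inj₂)
  open import Data.Empty using (⊥-elim)
  open import Function using (_∘_)
  open import Relation.Binary.PropositionalEquality
  open ≡-Reasoning

  ∑< : ℕ → (ℕ → ℤ) → ℤ
  ∑< zero    f = 0ℤ
  ∑< (suc n) f = ∑< n f + f n

  infixl 10 ∑<
  syntax ∑< n (λ k → e) = ∑[ k < n ] e

  ∑-cong : ∀ n {f g : ℕ → ℤ} → (∀ {k} → k < n → f k ≡ g k) → ∑< n f ≡ ∑< n g
  ∑-cong zero    f≗g = refl
  ∑-cong (suc n) f≗g = cong₂ _+_ (∑-cong n (f≗g ∘ ℕ.m<n⇒m<1+n)) (f≗g (ℕ.n<1+n n))

  ∑-zero : ∀ n {f : ℕ → ℤ} → (∀ {k} → k < n → f k ≡ 0ℤ) → ∑< n f ≡ 0ℤ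
  ∑-zero zero    f≗0 = refl
  ∑-zero (suc n) f≗0 = cong₂ _+_ (∑-zero n (f≗0 ∘ ℕ.m<n⇒m<1+n)) (f≗0 (ℕ.n<1+n n))

  ∑-distrib-+ : ∀ n (f g : ℕ → ℤ) → ∑[ k < n ] (f k + g k) ≡ ∑< n f + ∑< n g
  ∑-distrib-+ zero    f g = refl
  ∑-distrib-+ (suc n) f g = begin
    ∑[ k < n ] (f k + g k) + (f n + g n)  ≡⟨ cong (_+ (f n + g n)) (∑-distrib-+ n f g) ⟩
    ∑< n f + ∑< n g + (f n + g n)         ≡⟨ interchange (∑< n f) (∑< n g) (f n) (g n) ⟩
    ∑< n f + f n + (∑< n g + g n)         ∎
    where
    interchange : ∀ a b c d → a + b + (c + d) ≡ a + c + (b + d)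
    interchange = solve-∀

  ∑-linear : ∀ n a b (f g : ℕ → ℤ) → ∑[ k < n ] (a * f k - b * g k) ≡ a * ∑< n f - b * ∑< n g
  ∑-linear zero    a b f g = zero-combination a b
    where
    zero-combination : ∀ a b → 0ℤ ≡ a * 0ℤ - b * 0ℤ
    zero-combination = solve-∀
  ∑-linear (suc n) a b f g = begin
    ∑[ k < n ] (a * f k - b * g k) + (a * f n - b * g n)
      ≡⟨ cong (_+ (a * f n - b * g n)) (∑-linear n a b f g) ⟩
    a * ∑< n f - b * ∑< n g + (a * f n - b * g n)
      ≡⟨ regroup a b (∑< n f) (∑< n g) (f n) (g n) ⟩
    a * (∑< n f + f n) - b * (∑< n g + g n) ∎
    where
    regroup : ∀ a b x y u v → a * x - b * y + (a * u - b * v) ≡ a * (x + u) - b * (y + v)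
    regroup = solve-∀

  ∑-head : ∀ n (f : ℕ → ℤ) → ∑< (suc n) f ≡ f 0 + ∑[ k < n ] (f (suc k))
  ∑-head zero    f = ℤ.+-comm 0ℤ (f 0)
  ∑-head (suc n) f = trans (cong (_+ f (suc n)) (∑-head n f)) (ℤ.+-assoc (f 0) _ _)

  sgn : ℕ → ℤ
  sgn k = -1ℤ ^ k

  sgn-double : ∀ t → sgn (t ℕ.+ t) ≡ 1ℤ
  sgn-double zero    = refl
  sgn-double (suc t) = begin
    sgn (suc t ℕ.+ suc t)       ≡⟨ cong (sgn ∘ suc) (ℕ.+-suc t t) ⟩
    -1ℤ * (-1ℤ * sgn (t ℕ.+ t)) ≡⟨ cong (λ s → -1ℤ * (-1ℤ * s)) (sgn-double t) ⟩
    1ℤ                          ∎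

  ∑-alternating-C : ∀ m j → ∑[ i < suc j ] (sgn i * + (suc m C i)) ≡ sgn j * + (m C j)
  ∑-alternating-C m zero    = refl
  ∑-alternating-C m (suc j) = begin
    ∑[ i < suc j ] (sgn i * + (suc m C i)) + sgn (suc j) * + (suc m C suc j)
      ≡⟨ cong₂ (λ s c → s + sgn (suc j) * + c) (∑-alternating-C m j) (sym (nCk+nC[k+1]≡[n+1]C[k+1] m j)) ⟩
    sgn j * + (m C j) + -1ℤ * sgn j * + (m C j ℕ.+ m C suc j)
      ≡⟨ cong (λ c → sgn j * + (m C j) + -1ℤ * sgn j * c) (ℤ.pos-+ (m C j) (m C suc j)) ⟩
    sgn j * + (m C j) + -1ℤ * sgn j * (+ (m C j) + + (m C suc j))
      ≡⟨ telescope (sgn j) (+ (m C j)) (+ (m C suc j)) ⟩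
    sgn (suc j) * + (m C suc j) ∎
    where
    telescope : ∀ s a b → s * a + -1ℤ * s * (a + b) ≡ -1ℤ * s * b
    telescope = solve-∀

  ∑-alternating-C≡0 : ∀ m → ∑[ i < suc (suc m) ] (sgn i * + (suc m C i)) ≡ 0ℤ
  ∑-alternating-C≡0 m = begin
    ∑[ i < suc (suc m) ] (sgn i * + (suc m C i)) ≡⟨ ∑-alternating-C m (suc m) ⟩
    sgn (suc m) * + (m C suc m)                  ≡⟨ cong (λ c → sgn (suc m) * + c) (k>n⇒nCk≡0 (ℕ.n<1+n m)) ⟩
    sgn (suc m) * 0ℤ                             ≡⟨ ℤ.*-zeroʳ (sgn (suc m)) ⟩
    0ℤ                                           ∎

  pos*i≡0⇒i≡0 : ∀ m .{{_ : ℕ.NonZero m}} {i} → + m * i ≡ 0ℤ → i ≡ 0ℤ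
  pos*i≡0⇒i≡0 m m*i≡0 with ℤ.i*j≡0⇒i≡0∨j≡0 (+ m) m*i≡0
  ... | inj₁ m≡0 = ⊥-elim (ℕ.≢-nonZero⁻¹ m (ℤ.+-injective m≡0))
  ... | inj₂ i≡0 = i≡0

module EulerArithmetic where

  open import Data.Nat as ℕ using (zero; suc; _∸_; _!; _≤_; _<_; z≤n; s≤s; >-nonZero)
  import Data.Nat.Properties as ℕ
  open import Data.Nat.Combinatorics as C using (_C_; nCn≡1; nC1≡n)
  open import Data.Nat.DivMod using (m/n*n≡m)
  open import Data.Integer as ℤ using (ℤ; +_; 0ℤ; 1ℤ; -1ℤ; _+_; _*_; _-_)
  import Data.Integer.Properties as ℤ
  open import Data.Integer.Tactic.RingSolver using (solve-∀)
  open import Data.Product using (_×_; _,_)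
  open import Data.Sum using (inj₁; inj₂)
  open import Data.Empty using (⊥-elim)
  open import Function using (_∘_)
  open import Algebra.Properties.CommutativeSemigroup ℕ.*-commutativeSemigroup using (x∙yz≈y∙xz)
  open import Relation.Binary.PropositionalEquality
  open ≡-Reasoning
  open IntegerSums

  C*factorials≡! : ∀ {n k} → k ≤ n → (n C k) ℕ.* (k ! ℕ.* (n ∸ k) !) ≡ n !
  C*factorials≡! {n} {k} k≤n =
    trans (cong (ℕ._* (k ! ℕ.* (n ∸ k) !)) (C.nCk≡n!/k![n-k]! k≤n)) (m/n*n≡m (C.k![n∸k]!∣n! k≤n))
    where instance _ = k ℕ.!* (n ∸ k) !≢0

  factorialWith : (ℕ → ℕ) → ℕ → ℕ
  factorialWith A zero    = 1
  factorialWith A (suc n) = A (suc n) ℕ.* factorialWith A n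

  factorialWith-id : ∀ (A : ℕ → ℕ) n → (∀ {k} → k ≤ n → A k ≡ k) → factorialWith A n ≡ n !
  factorialWith-id A zero    A≗id = refl
  factorialWith-id A (suc n) A≗id = cong₂ ℕ._*_ (A≗id ℕ.≤-refl) (factorialWith-id A n (A≗id ∘ ℕ.m≤n⇒m≤1+n))

  euler-length-two : ∀ (N : ℕ → ℕ) → N 0 ≡ 1 → N 2 ≡ 1 → ∑[ i < 3 ] (sgn i * + N i) ≡ 0ℤ → N 1 ≡ 2
  euler-length-two N N₀≡1 N₂≡1 euler = ℤ.+-injective (sym (ℤ.i-j≡0⇒i≡j (+ 2) (+ N 1) (begin
    + 2 - + N 1
      ≡⟨ rearrange (+ N 1) ⟩
    0ℤ + 1ℤ * + 1 + -1ℤ * 1ℤ * + N 1 + -1ℤ * (-1ℤ * 1ℤ) * + 1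
      ≡⟨ cong₂ (λ u v → 0ℤ + 1ℤ * + u + -1ℤ * 1ℤ * + N 1 + -1ℤ * (-1ℤ * 1ℤ) * + v)
               (sym N₀≡1) (sym N₂≡1) ⟩
    ∑[ i < 3 ] (sgn i * + N i)
      ≡⟨ euler ⟩
    0ℤ ∎)))
    where
    rearrange : ∀ x → + 2 - x ≡ 0ℤ + 1ℤ * + 1 + -1ℤ * 1ℤ * x + -1ℤ * (-1ℤ * 1ℤ) * + 1
    rearrange = solve-∀

  solve-1+m+βα≡[1+m]β : ∀ m α β → m ≤ α → suc m ℕ.+ β ℕ.* α ≡ suc m ℕ.* β → α ≡ m × β ≡ suc m
  solve-1+m+βα≡[1+m]β m α β m≤α eq with ℕ.m≤n⇒m<n∨m≡n m≤α
  ... | inj₁ m<α =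
    ⊥-elim (ℕ.<-irrefl refl (ℕ.≤-<-trans [1+m]β≤βα (subst (β ℕ.* α <_) eq (ℕ.m<n+m (β ℕ.* α) (s≤s z≤n)))))
    where
    [1+m]β≤βα : suc m ℕ.* β ≤ β ℕ.* α
    [1+m]β≤βα = ℕ.≤-trans (ℕ.≤-reflexive (ℕ.*-comm (suc m) β)) (ℕ.*-monoʳ-≤ β m<α)
  ... | inj₂ refl = refl , ℕ.+-cancelʳ-≡ (β ℕ.* m) β (suc m) (begin
    β ℕ.+ β ℕ.* m     ≡⟨ cong (β ℕ.+_) (ℕ.*-comm β m) ⟩
    suc m ℕ.* β       ≡⟨ eq ⟨
    suc m ℕ.+ β ℕ.* m ∎)

  id-upto-suc : ∀ {f : ℕ → ℕ} {n} → (∀ {k} → k ≤ n → f k ≡ k) → f (suc n) ≡ suc n →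
                ∀ {k} → k ≤ suc n → f k ≡ k
  id-upto-suc f≗id f[1+n]≡ k≤1+n with ℕ.m≤n⇒m<n∨m≡n k≤1+n
  ... | inj₁ (s≤s k≤n) = f≗id k≤n
  ... | inj₂ refl      = f[1+n]≡

  module EvenLengthStep (q : ℕ) (sgn[q]≡1 : sgn q ≡ 1ℤ) (A N : ℕ → ℕ) where

    p n α β : ℕ
    p = suc (suc q)
    n = suc (suc p)
    α = A (suc p)
    β = A n

    F : ℕ → ℕ
    F = factorialWith A

    module _ (A≗id : ∀ {k} → k ≤ p → A k ≡ k) (p<α : p < α) (0<β : 0 < β)
             (levels : ∀ {i} → i ≤ n → N i ℕ.* (F i ℕ.* F (n ∸ i)) ≡ F n)
             (euler : ∑[ i < suc n ] (sgn i * + N i) ≡ 0ℤ) where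

      c : ℕ
      c = α ℕ.* p !

      instance
        c≢0 : ℕ.NonZero c
        c≢0 = ℕ.m*n≢0 α (p !) {{>-nonZero (ℕ.<-≤-trans (s≤s z≤n) p<α)}} {{p ℕ.!≢0}}
        βc≢0 : ℕ.NonZero (β ℕ.* c)
        βc≢0 = ℕ.m*n≢0 β c {{>-nonZero 0<β}}

      F≡! : ∀ {k} → k ≤ p → F k ≡ k !
      F≡! {k} k≤p = factorialWith-id A k (λ j≤k → A≗id (ℕ.≤-trans j≤k k≤p))

      F[1+p] : F (suc p) ≡ c
      F[1+p] = cong (α ℕ.*_) (F≡! ℕ.≤-refl)

      F[n] : F n ≡ β ℕ.* c
      F[n] = cong (β ℕ.*_) F[1+p]

      private
        N≡ : ∀ {i} u {w} .{{_ : ℕ.NonZero w}} → i ≤ n → F i ℕ.* F (n ∸ i) ≡ w → F n ≡ u ℕ.* w → N i ≡ u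
        N≡ {i} u {w} i≤n Fw Fn = ℕ.*-cancelʳ-≡ (N i) u w (trans (cong (N i ℕ.*_) (sym Fw)) (trans (levels i≤n) Fn))

      N[0] : N 0 ≡ 1
      N[0] = N≡ 1 z≤n (trans (ℕ.*-identityˡ (F n)) F[n]) (trans F[n] (sym (ℕ.*-identityˡ _)))

      N[n] : N n ≡ 1
      N[n] = N≡ 1 ℕ.≤-refl
        (trans (cong (λ k → F n ℕ.* F k) (ℕ.n∸n≡0 n)) (trans (ℕ.*-identityʳ (F n)) F[n]))
        (trans F[n] (sym (ℕ.*-identityˡ _)))

      N[1] : N 1 ≡ β
      N[1] = N≡ β (s≤s z≤n) (trans (cong (ℕ._* F (suc p)) (F≡! (s≤s z≤n))) (trans (ℕ.*-identityˡ _) F[1+p])) F[n]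

      N[1+p] : N (suc p) ≡ β
      N[1+p] = N≡ β (ℕ.n≤1+n (suc p))
        (trans (cong (λ k → F (suc p) ℕ.* F k) (ℕ.m+n∸n≡m 1 p))
          (trans (cong₂ ℕ._*_ F[1+p] (F≡! (s≤s z≤n))) (ℕ.*-identityʳ c)))
        F[n]

      N[2+k] : ∀ {k} → k ≤ q → N (2 ℕ.+ k) ℕ.* n ! ≡ (n C (2 ℕ.+ k)) ℕ.* (β ℕ.* c)
      N[2+k] {k} k≤q = begin
        N i ℕ.* n !                               ≡⟨ cong (N i ℕ.*_) (C*factorials≡! i≤n) ⟨
        N i ℕ.* ((n C i) ℕ.* X)                   ≡⟨ x∙yz≈y∙xz (N i) (n C i) X ⟩
        (n C i) ℕ.* (N i ℕ.* X)                   ≡⟨ cong (λ w → (n C i) ℕ.* (N i ℕ.* w)) F≡X ⟨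
        (n C i) ℕ.* (N i ℕ.* (F i ℕ.* F (n ∸ i))) ≡⟨ cong ((n C i) ℕ.*_) (trans (levels i≤n) F[n]) ⟩
        (n C i) ℕ.* (β ℕ.* c)                     ∎
        where
        i X : ℕ
        i = 2 ℕ.+ k
        X = i ! ℕ.* (n ∸ i) !
        i≤n : i ≤ n
        i≤n = s≤s (s≤s (ℕ.m≤n⇒m≤1+n (ℕ.m≤n⇒m≤1+n k≤q)))
        F≡X : F i ℕ.* F (n ∸ i) ≡ X
        F≡X = cong₂ ℕ._*_ (F≡! (s≤s (s≤s k≤q))) (F≡! (ℕ.m∸n≤m p k))

      -- defect i is 0 for 2 ≤ i ≤ p, and Σ defect = 0 because the alternating sums of N and of n C_
      -- vanish; the four remaining terms add up to 2 p! (p + 1) (n + βα - nβ).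
      private
        a b : ℤ
        a = + (n !)
        b = + (β ℕ.* c)

        defect : ℕ → ℤ
        defect i = a * (sgn i * + N i) - b * (sgn i * + (n C i))

        factor-sgn : ∀ s x y u v → x * (s * u) - y * (s * v) ≡ s * (x * u - y * v)
        factor-sgn = solve-∀

        defect-at : ∀ i {u v} → N i ≡ u → n C i ≡ v → defect i ≡ sgn i * (a * + u - b * + v)
        defect-at i refl refl = factor-sgn (sgn i) a b (+ N i) (+ (n C i))

      ∑defect≡0 : ∑< (suc n) defect ≡ 0ℤ
      ∑defect≡0 = begin
        ∑< (suc n) defect
          ≡⟨ ∑-linear (suc n) a b (λ i → sgn i * + N i) (λ i → sgn i * + (n C i)) ⟩
        a * ∑[ i < suc n ] (sgn i * + N i) - b * ∑[ i < suc n ] (sgn i * + (n C i))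
          ≡⟨ cong₂ (λ x y → a * x - b * y) euler (∑-alternating-C≡0 (suc p)) ⟩
        a * 0ℤ - b * 0ℤ
          ≡⟨ cong₂ _-_ (ℤ.*-zeroʳ a) (ℤ.*-zeroʳ b) ⟩
        0ℤ ∎

      defect[2+k]≡0 : ∀ {k} → k < suc q → defect (2 ℕ.+ k) ≡ 0ℤ
      defect[2+k]≡0 {k} (s≤s k≤q) = begin
        defect i                                 ≡⟨ defect-at i refl refl ⟩
        sgn i * (a * + N i - b * + (n C i))      ≡⟨ cong (λ x → sgn i * (x - b * + (n C i))) a*N≡b*C ⟩
        sgn i * (b * + (n C i) - b * + (n C i))  ≡⟨ cong (sgn i *_) (ℤ.+-inverseʳ (b * + (n C i))) ⟩
        sgn i * 0ℤ                               ≡⟨ ℤ.*-zeroʳ (sgn i) ⟩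
        0ℤ                                       ∎
        where
        i : ℕ
        i = 2 ℕ.+ k
        a*N≡b*C : a * + N i ≡ b * + (n C i)
        a*N≡b*C = begin
          a * + N i                 ≡⟨ ℤ.pos-* (n !) (N i) ⟨
          + (n ! ℕ.* N i)           ≡⟨ cong +_ (trans (ℕ.*-comm (n !) (N i)) (trans (N[2+k] k≤q) (ℕ.*-comm (n C i) _))) ⟩
          + (β ℕ.* c ℕ.* (n C i))   ≡⟨ ℤ.pos-* (β ℕ.* c) (n C i) ⟩
          b * + (n C i)             ∎

      ∑defect-boundary : ∑< (suc n) defect
                       ≡ defect 0 + (defect 1 + ∑[ k < suc q ] (defect (2 ℕ.+ k))) + defect (suc p) + defect n
      ∑defect-boundary = cong (λ s → s + defect (suc p) + defect n)
        (trans (∑-head (suc (suc q)) defect) (cong (λ s → defect 0 + s) (∑-head (suc q) (defect ∘ suc))))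

      private
        X Y Z : ℤ
        X = a * + 1 - b * + 1
        Y = a * + β - b * + n
        Z = + n + + β * + α - + n * + β

        sgn[p] : sgn p ≡ 1ℤ
        sgn[p] = cong (λ s → -1ℤ * (-1ℤ * s)) sgn[q]≡1

        a≡ : a ≡ + n * (+ suc p * + (p !))
        a≡ = trans (ℤ.pos-* n (suc p ℕ.* p !)) (cong (+ n *_) (ℤ.pos-* (suc p) (p !)))

        b≡ : b ≡ + β * (+ α * + (p !))
        b≡ = trans (ℤ.pos-* β c) (cong (+ β *_) (ℤ.pos-* α (p !)))

        collect : ∀ Q P B Al →
          let a = (1ℤ + Q) * (Q * P); b = B * (Al * P) in
          1ℤ * (a * 1ℤ - b * 1ℤ) + (-1ℤ * 1ℤ * (a * B - b * (1ℤ + Q)) + 0ℤ)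
            + -1ℤ * 1ℤ * (a * B - b * (1ℤ + Q)) + -1ℤ * (-1ℤ * 1ℤ) * (a * 1ℤ - b * 1ℤ)
          ≡ + 2 * (Q * P) * ((1ℤ + Q) + B * Al - (1ℤ + Q) * B)
        collect = solve-∀

        nC[1+p]≡n : n C suc p ≡ n
        nC[1+p]≡n = trans (C.nCk≡nC[n∸k] (ℕ.n≤1+n (suc p))) (trans (cong (n C_) (ℕ.m+n∸n≡m 1 (suc p))) (nC1≡n n))

      2[1+p]p!*Z≡0 : + 2 * (+ suc p * + (p !)) * Z ≡ 0ℤ
      2[1+p]p!*Z≡0 = begin
        + 2 * (+ suc p * + (p !)) * Z
          ≡⟨ collect (+ suc p) (+ (p !)) (+ β) (+ α) ⟨
        1ℤ * (a′ * 1ℤ - b′ * 1ℤ) + (-1ℤ * 1ℤ * (a′ * + β - b′ * + n) + 0ℤ)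
          + -1ℤ * 1ℤ * (a′ * + β - b′ * + n) + -1ℤ * (-1ℤ * 1ℤ) * (a′ * 1ℤ - b′ * 1ℤ)
          ≡⟨ cong₂ (λ x y → 1ℤ * (x * 1ℤ - y * 1ℤ) + (-1ℤ * 1ℤ * (x * + β - y * + n) + 0ℤ)
                            + -1ℤ * 1ℤ * (x * + β - y * + n) + -1ℤ * (-1ℤ * 1ℤ) * (x * 1ℤ - y * 1ℤ))
                   (sym a≡) (sym b≡) ⟩
        1ℤ * X + (-1ℤ * 1ℤ * Y + 0ℤ) + -1ℤ * 1ℤ * Y + -1ℤ * (-1ℤ * 1ℤ) * X
          ≡⟨ cong (λ s → 1ℤ * X + (-1ℤ * 1ℤ * Y + 0ℤ) + -1ℤ * s * Y + -1ℤ * (-1ℤ * s) * X) sgn[p] ⟨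
        sgn 0 * X + (sgn 1 * Y + 0ℤ) + sgn (suc p) * Y + sgn n * X
          ≡⟨ cong₂ _+_ (cong₂ _+_ (cong₂ (λ u v → u + (v + 0ℤ))
               (defect-at 0 N[0] refl) (defect-at 1 N[1] (nC1≡n n)))
               (defect-at (suc p) N[1+p] nC[1+p]≡n)) (defect-at n N[n] (nCn≡1 n)) ⟨
        defect 0 + (defect 1 + 0ℤ) + defect (suc p) + defect n
          ≡⟨ cong (λ s → defect 0 + (defect 1 + s) + defect (suc p) + defect n) (∑-zero (suc q) defect[2+k]≡0) ⟨
        defect 0 + (defect 1 + ∑[ k < suc q ] (defect (2 ℕ.+ k))) + defect (suc p) + defect n
          ≡⟨ ∑defect-boundary ⟨
        ∑< (suc n) defect
          ≡⟨ ∑defect≡0 ⟩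
        0ℤ ∎
        where
        a′ b′ : ℤ
        a′ = + n * (+ suc p * + (p !))
        b′ = + β * (+ α * + (p !))

      n+βα≡nβ : n ℕ.+ β ℕ.* α ≡ n ℕ.* β
      n+βα≡nβ = ℤ.+-injective (begin
        + (n ℕ.+ β ℕ.* α)    ≡⟨ trans (ℤ.pos-+ n (β ℕ.* α)) (cong (λ x → + n + x) (ℤ.pos-* β α)) ⟩
        + n + + β * + α      ≡⟨ ℤ.i-j≡0⇒i≡j _ _ (pos*i≡0⇒i≡0 (2 ℕ.* (suc p ℕ.* p !)) 2[1+p]p!′*Z≡0) ⟩
        + n * + β            ≡⟨ ℤ.pos-* n β ⟨
        + (n ℕ.* β)          ∎)
        where
        instance _ = ℕ.m*n≢0 2 (suc p ℕ.* p !) {{_}} {{ℕ.m*n≢0 (suc p) (p !) {{_}} {{p ℕ.!≢0}}}}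
        2[1+p]p!′*Z≡0 : + (2 ℕ.* (suc p ℕ.* p !)) * Z ≡ 0ℤ
        2[1+p]p!′*Z≡0 = trans (cong (_* Z) (trans (ℤ.pos-* 2 (suc p ℕ.* p !)) (cong (+ 2 *_) (ℤ.pos-* (suc p) (p !)))))
                              2[1+p]p!*Z≡0

      α≡1+p×β≡n : α ≡ suc p × β ≡ n
      α≡1+p×β≡n = solve-1+m+βα≡[1+m]β (suc p) α β p<α n+βα≡nβ

module ListCounting {c ℓ} (S : Setoid c ℓ) where

  open import Level using (_⊔_)
  open import Data.Nat using (suc; _≤_; _<_; z≤n; s≤s)
  open import Data.Nat.Properties using (≤-antisym; <-irrefl; ≤-trans)
  open import Data.List using (List; []; _∷_; length; filter; map)
  open import Data.List.Properties using (length-removeAt′)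
  open import Data.List.Relation.Unary.All as All using (All; []; _∷_)
  import Data.List.Relation.Unary.All.Properties as All
  open import Data.List.Relation.Unary.AllPairs using ([]; _∷_)
  open import Data.List.Relation.Unary.Any as Any using (here; there; index; _─_)
  import Data.List.Membership.Setoid.Properties as Membershipₚ
  import Data.List.Relation.Unary.Unique.Setoid.Properties as Uniqueₚ
  open import Data.Product using (∃-syntax; _×_; _,_; proj₁)
  open import Data.Empty using (⊥-elim)
  open import Function using (_∘_)
  open import Relation.Nullary using (¬_; yes; no)
  open import Relation.Unary using (Pred; Decidable)
  open import Relation.Binary using (Rel; _Respects_)
  import Relation.Binary.Definitions as B
  open import Relation.Binary.PropositionalEquality as ≡ using (_≡_)

  open Setoid S renaming (Carrier to A)
  open import Data.List.Membership.Setoid S public using (_∈_; _∉_)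
  open import Data.List.Relation.Unary.Unique.Setoid S public using (Unique)

  infix 4 _⊑_
  _⊑_ : Rel (List A) (c ⊔ ℓ)
  xs ⊑ ys = All (_∈ ys) xs

  ∈-⊑ : ∀ {x xs ys} → x ∈ xs → xs ⊑ ys → x ∈ ys
  ∈-⊑ (here x≈y)   (y∈ys ∷ _)  = Membershipₚ.∈-resp-≈ S (sym x≈y) y∈ys
  ∈-⊑ (there x∈xs) (_ ∷ xs⊑ys) = ∈-⊑ x∈xs xs⊑ys

  ∈-─⁺ : ∀ {x y ys} (x∈ys : x ∈ ys) → y ∈ ys → ¬ y ≈ x → y ∈ (ys ─ x∈ys)
  ∈-─⁺ (here x≈z)   (here y≈z)   y≉x = ⊥-elim (y≉x (trans y≈z (sym x≈z)))
  ∈-─⁺ (here _)     (there y∈ys) _   = y∈ys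
  ∈-─⁺ (there _)    (here y≈z)   _   = here y≈z
  ∈-─⁺ (there x∈ys) (there y∈ys) y≉x = there (∈-─⁺ x∈ys y∈ys y≉x)

  length-mono : ∀ {xs ys} → Unique xs → xs ⊑ ys → length xs ≤ length ys
  length-mono {[]}          _             _               = z≤n
  length-mono {x ∷ xs} {ys} (x≉xs ∷ xs!) (x∈ys ∷ xs⊑ys) =
    ≡.subst (suc (length xs) ≤_) (≡.sym (length-removeAt′ ys (index x∈ys)))
      (s≤s (length-mono xs! (All.zipWith (λ (y∈ys , x≉y) → ∈-─⁺ x∈ys y∈ys (x≉y ∘ sym)) (xs⊑ys , x≉xs))))

  length-mono-< : ∀ {x xs ys} → Unique xs → xs ⊑ ys → x ∈ ys → x ∉ xs → length xs < length ys
  length-mono-< xs! xs⊑ys x∈ys x∉xs = length-mono (Membershipₚ.∉⇒All[≉] S x∉xs ∷ xs!) (x∈ys ∷ xs⊑ys)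

  length-≡ : ∀ {xs ys} → Unique xs → Unique ys → xs ⊑ ys → ys ⊑ xs → length xs ≡ length ys
  length-≡ xs! ys! xs⊑ys ys⊑xs = ≤-antisym (length-mono xs! xs⊑ys) (length-mono ys! ys⊑xs)

  ⊑-complete : B.Decidable _≈_ → ∀ {xs ys} → Unique xs → xs ⊑ ys → length ys ≤ length xs → ys ⊑ xs
  ⊑-complete _≟_ {xs} xs! xs⊑ys ys≤xs = All.tabulateₛ S (λ {y} → in-xs y)
    where
    in-xs : ∀ y → y ∈ _ → y ∈ xs
    in-xs y y∈ys with Any.any? (y ≟_) xs
    ... | yes y∈xs = y∈xs
    ... | no  y∉xs = ⊥-elim (<-irrefl ≡.refl (≤-trans (length-mono-< xs! xs⊑ys y∈ys y∉xs) ys≤xs))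

  element-≉ : B.Decidable _≈_ → ∀ {xs} → Unique xs → 2 ≤ length xs → ∀ a → ∃[ w ] (w ∈ xs × ¬ w ≈ a)
  element-≉ _≟_ {_ ∷ []}    _                 (s≤s ())
  element-≉ _≟_ {u ∷ v ∷ _} ((u≉v ∷ _) ∷ _) _ a with u ≟ a
  ... | no  u≉a = u , here refl , u≉a
  ... | yes u≈a = v , there (here refl) , λ v≈a → u≉v (trans u≈a (sym v≈a))

  IsEnumeration : ∀ {p} → Pred A p → List A → Set (c ⊔ ℓ ⊔ p)
  IsEnumeration P xs = All P xs × Unique xs × (∀ x → P x → x ∈ xs)

  enumeration-⇔ : ∀ {p q} {P : Pred A p} {Q : Pred A q} {xs} →
    (∀ {x} → P x → Q x) → (∀ {x} → Q x → P x) → IsEnumeration P xs → IsEnumeration Q xs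
  enumeration-⇔ P⇒Q Q⇒P (Pxs , xs! , P⊆xs) = All.map P⇒Q Pxs , xs! , λ x → P⊆xs x ∘ Q⇒P

  enumeration-length : ∀ {p q} {P : Pred A p} {Q : Pred A q} {xs ys} →
    (∀ {x} → P x → Q x) → (∀ {x} → Q x → P x) →
    IsEnumeration P xs → IsEnumeration Q ys → length xs ≡ length ys
  enumeration-length P⇒Q Q⇒P (Pxs , xs! , P⊆xs) (Qys , ys! , Q⊆ys) =
    length-≡ xs! ys! (All.map (Q⊆ys _ ∘ P⇒Q) Pxs) (All.map (P⊆xs _ ∘ Q⇒P) Qys)

  singleton-enumeration-length : ∀ {p} {P : Pred A p} {a xs} → P Respects _≈_ →
    P a → (∀ {x} → P x → x ≈ a) → IsEnumeration P xs → length xs ≡ 1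
  singleton-enumeration-length resp Pa P⇒≈a enum =
    enumeration-length P⇒≈a (λ x≈a → resp (sym x≈a) Pa) enum (refl ∷ [] , [] ∷ [] , λ _ x≈a → here x≈a)

  map-proj₁-toList : ∀ {p} {Q : Pred A p} {xs} (qs : All Q xs) → map proj₁ (All.toList qs) ≡ xs
  map-proj₁-toList []       = ≡.refl
  map-proj₁-toList (_ ∷ qs) = ≡.cong (_ ∷_) (map-proj₁-toList qs)

  filter-enumeration : ∀ {p q} {P : Pred A p} {Q : Pred A q} (Q? : Decidable Q) → Q Respects _≈_ →
    ∀ {xs} → IsEnumeration P xs → IsEnumeration (λ x → P x × Q x) (filter Q? xs)
  filter-enumeration Q? resp {xs} (Pxs , xs! , P⊆xs) =
    All.zip (All.filter⁺ Q? Pxs , All.all-filter Q? xs) ,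
    Uniqueₚ.filter⁺ S Q? xs! ,
    λ x (Px , Qx) → Membershipₚ.∈-filter⁺ S Q? resp (P⊆xs x Px) Qx

module FilterCounting where

  open import Data.Nat using (_+_)
  open import Data.Bool using (true; false; if_then_else_)
  open import Data.List using (_∷_; length; filter)
  open import Data.Empty using (⊥-elim)
  open import Relation.Nullary using (¬_; yes; no; does)
  open import Relation.Unary using (Pred; Decidable)
  open import Relation.Binary.PropositionalEquality using (_≡_; refl)

  indicator : ∀ {p} {P : Set p} → Dec P → ℕ
  indicator d = if does d then 1 else 0

  indicator-yes : ∀ {p} {P : Set p} (d : Dec P) → P → indicator d ≡ 1
  indicator-yes (yes _)  _ = refl
  indicator-yes (no ¬p)  p = ⊥-elim (¬p p)

  indicator-no : ∀ {p} {P : Set p} (d : Dec P) → ¬ P → indicator d ≡ 0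
  indicator-no (yes p) ¬p = ⊥-elim (¬p p)
  indicator-no (no _)  _  = refl

  length-filter-∷ : ∀ {c p} {C : Set c} {P : Pred C p} (P? : Decidable P) x xs →
    length (filter P? (x ∷ xs)) ≡ indicator (P? x) + length (filter P? xs)
  length-filter-∷ P? x xs with does (P? x)
  ... | true  = refl
  ... | false = refl

module DoubleCounting {a b r} {A : Set a} {B : Set b} {R : A → B → Set r} (R? : ∀ x y → Dec (R x y)) where

  open import Data.Nat using (_+_; _*_)
  open import Data.Nat.Properties using (+-commutativeSemigroup; *-distribʳ-+)
  open import Algebra.Properties.CommutativeSemigroup +-commutativeSemigroup using (interchange)
  open import Data.Nat.ListAction using (sum)
  open import Data.List using (List; []; _∷_; length; filter; map)
  open import Data.List.Properties using (map-cong)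
  open import Data.List.Relation.Unary.All using (All; []; _∷_)
  open import Relation.Unary using (Pred; Decidable)
  open import Relation.Binary.PropositionalEquality
  open FilterCounting

  private
    sum-map-indicator : ∀ {c p} {C : Set c} {P : Pred C p} (P? : Decidable P) xs →
      sum (map (λ x → indicator (P? x)) xs) ≡ length (filter P? xs)
    sum-map-indicator P? []       = refl
    sum-map-indicator P? (x ∷ xs) = trans (cong (indicator (P? x) +_) (sum-map-indicator P? xs)) (sym (length-filter-∷ P? x xs))

    sum-map-+ : ∀ {c} {C : Set c} (f g : C → ℕ) xs → sum (map (λ x → f x + g x) xs) ≡ sum (map f xs) + sum (map g xs)
    sum-map-+ f g []       = refl
    sum-map-+ f g (x ∷ xs) = trans (cong (f x + g x +_) (sum-map-+ f g xs)) (interchange (f x) (g x) _ _)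

    sum-map-0 : ∀ {c} {C : Set c} (xs : List C) → sum (map (λ _ → 0) xs) ≡ 0
    sum-map-0 []       = refl
    sum-map-0 (_ ∷ xs) = sum-map-0 xs

    sum-map-const : ∀ {c} {C : Set c} {f : C → ℕ} {k xs} → All (λ x → f x ≡ k) xs → sum (map f xs) ≡ length xs * k
    sum-map-const []           = refl
    sum-map-const (fx≡k ∷ fxs) = cong₂ _+_ fx≡k (sum-map-const fxs)

    sum-map-*ʳ : ∀ {c} {C : Set c} (f : C → ℕ) d xs → sum (map f xs) * d ≡ sum (map (λ x → f x * d) xs)
    sum-map-*ʳ f d []       = refl
    sum-map-*ʳ f d (x ∷ xs) = trans (*-distribʳ-+ d (f x) _) (cong (f x * d +_) (sum-map-*ʳ f d xs))

  double-count : ∀ xs ys →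
    sum (map (λ y → length (filter (λ x → R? x y) xs)) ys) ≡ sum (map (λ x → length (filter (R? x) ys)) xs)
  double-count []       ys = sum-map-0 ys
  double-count (x ∷ xs) ys = begin
    sum (map (λ y → length (filter (λ x′ → R? x′ y) (x ∷ xs))) ys)
      ≡⟨ cong sum (map-cong (λ y → length-filter-∷ (λ x′ → R? x′ y) x xs) ys) ⟩
    sum (map (λ y → indicator (R? x y) + length (filter (λ x′ → R? x′ y) xs)) ys)
      ≡⟨ sum-map-+ (λ y → indicator (R? x y)) (λ y → length (filter (λ x′ → R? x′ y) xs)) ys ⟩
    sum (map (λ y → indicator (R? x y)) ys) + sum (map (λ y → length (filter (λ x′ → R? x′ y) xs)) ys)
      ≡⟨ cong₂ _+_ (sum-map-indicator (R? x) ys) (double-count xs ys) ⟩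
    length (filter (R? x) ys) + sum (map (λ x′ → length (filter (R? x′) ys)) xs) ∎
    where open ≡-Reasoning

  double-count-regular : ∀ {xs ys k d e} →
    All (λ y → length (filter (λ x → R? x y) xs) ≡ k) ys →
    All (λ x → length (filter (R? x) ys) * d ≡ e) xs →
    length ys * k * d ≡ length xs * e
  double-count-regular {xs} {ys} {k} {d} {e} regular-ys regular-xs = begin
    length ys * k * d                                          ≡⟨ cong (_* d) (sum-map-const regular-ys) ⟨
    sum (map (λ y → length (filter (λ x → R? x y) xs)) ys) * d ≡⟨ cong (_* d) (double-count xs ys) ⟩
    sum (map (λ x → length (filter (R? x) ys)) xs) * d         ≡⟨ sum-map-*ʳ (λ x → length (filter (R? x) ys)) d xs ⟩
    sum (map (λ x → length (filter (R? x) ys) * d) xs)         ≡⟨ sum-map-const regular-xs ⟩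
    length xs * e                                              ∎
    where open ≡-Reasoning

module GroupedSums where

  open import Data.Nat as ℕ using (suc; _≟_; _<_)
  import Data.Nat.Properties as ℕ
  open import Data.Integer as ℤ using (ℤ; +_; 0ℤ; _+_; _*_)
  import Data.Integer.Properties as ℤ
  open import Data.List using (List; []; _∷_; length; filter; map)
  open import Data.List.Relation.Unary.All using (All; []; _∷_)
  open import Function using (_∘_)
  open import Relation.Nullary using (yes; no)
  open import Relation.Binary.PropositionalEquality
  open IntegerSums
  open FilterCounting

  ∑-indicator : ∀ N (h : ℕ → ℤ) {j} → j < N → ∑[ k < N ] (h k * + indicator (j ≟ k)) ≡ h j
  ∑-indicator (suc N) h {j} j<1+N with j ≟ N
  ... | yes refl = trans (cong₂ _+_ (∑-zero N (λ k<N → off-diagonal (λ N≡k → ℕ.<-irrefl (sym N≡k) k<N)))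
                                    (cong (λ i → h N * + i) (indicator-yes (N ≟ N) refl)))
                         (trans (ℤ.+-identityˡ _) (ℤ.*-identityʳ (h N)))
    where
    off-diagonal : ∀ {k} → N ≢ k → h k * + indicator (N ≟ k) ≡ 0ℤ
    off-diagonal {k} N≢k = trans (cong (λ i → h k * + i) (indicator-no (N ≟ k) N≢k)) (ℤ.*-zeroʳ (h k))
  ... | no  j≢N = trans (cong₂ _+_ (∑-indicator N h (ℕ.≤∧≢⇒< (ℕ.≤-pred j<1+N) j≢N))
                                  (trans (cong (λ i → h N * + i) (indicator-no (j ≟ N) j≢N)) (ℤ.*-zeroʳ (h N))))
                        (ℤ.+-identityʳ (h j))

  sumℤ-grouped : ∀ {a} {W : Set a} (r : W → ℕ) (h : ℕ → ℤ) N ws → All (λ w → r w < N) ws →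
    sumℤ (map (h ∘ r) ws) ≡ ∑[ k < N ] (h k * + length (filter (λ w → r w ≟ k) ws))
  sumℤ-grouped r h N []       []             = sym (∑-zero N (λ {k} _ → ℤ.*-zeroʳ (h k)))
  sumℤ-grouped {W = W} r h N (w ∷ ws) (rw<N ∷ rws<N) = begin
    h (r w) + sumℤ (map (h ∘ r) ws)
      ≡⟨ cong₂ _+_ (sym (∑-indicator N h rw<N)) (sumℤ-grouped r h N ws rws<N) ⟩
    ∑[ k < N ] (h k * + indicator (r w ≟ k)) + ∑[ k < N ] (h k * + count k ws)
      ≡⟨ ∑-distrib-+ N _ _ ⟨
    ∑[ k < N ] (h k * + indicator (r w ≟ k) + h k * + count k ws)
      ≡⟨ ∑-cong N (λ {k} _ → sym (count-∷ k)) ⟩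
    ∑[ k < N ] (h k * + count k (w ∷ ws)) ∎
    where
    open ≡-Reasoning
    count : ℕ → List W → ℕ
    count k = length ∘ filter (λ v → r v ≟ k)
    count-∷ : ∀ k → h k * + count k (w ∷ ws) ≡ h k * + indicator (r w ≟ k) + h k * + count k ws
    count-∷ k = trans (cong (λ c → h k * + c) (length-filter-∷ (λ v → r v ≟ k) w ws))
                      (trans (cong (h k *_) (ℤ.pos-+ (indicator (r w ≟ k)) (count k ws))) (ℤ.*-distribˡ-+ (h k) _ _))

module GradedPoset {c ℓ₁ ℓ₂} (P : Poset c ℓ₁ ℓ₂)
  (finite : PosetNotions.LocallyFinite P) (_≈?_ : ∀ x y → Dec (Poset._≈_ P x y))
  (z : Poset.Carrier P) (bottom : PosetNotions.IsBottom P z)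
  (ρ : Poset.Carrier P → ℕ) (rank : PosetNotions.IsRankFunction P z ρ) where

  open import Level using (Lift; lift; lower)
  open import Data.Nat as ℕ using (zero; suc; _+_; _*_; _∸_; _≟_; z≤n; s≤s)
  import Data.Nat.Properties as ℕ
  open import Data.Nat.Induction using (<-wellFounded)
  open import Data.Nat.Tactic.RingSolver using (solve-∀)
  open import Data.Integer as ℤ using (0ℤ)
  open import Data.List using (List; []; _∷_; _++_; length; filter; map)
  open import Data.List.Properties using (length-map)
  open import Data.List.Relation.Unary.All as All using (All; []; _∷_)
  import Data.List.Relation.Unary.All.Properties as All
  import Data.List.Relation.Unary.Any as Any
  import Data.List.Relation.Unary.Any.Properties as Anyₚ
  open import Data.List.Relation.Binary.Pointwise as Pointwise using (Pointwise; _∷_)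
  import Data.List.Membership.Setoid.Properties as Membershipₚ
  import Data.List.Relation.Unary.Unique.Setoid.Properties as Uniqueₚ
  open import Data.Product using (∃; ∃-syntax; ∃₂; _×_; _,_; proj₁; proj₂)
  open import Data.Empty using (⊥; ⊥-elim)
  open import Function using (_∘_)
  open import Induction.WellFounded using (Acc; acc)
  open import Relation.Nullary using (¬_; yes; no)
  open import Relation.Nullary.Decidable using (_×-dec_; ¬?; map′)
  open import Relation.Binary using (Decidable)
  open import Relation.Binary.PropositionalEquality as ≡ using (_≡_)
  open import Relation.Binary.Properties.Poset P using (<-respˡ-≈; <-respʳ-≈)

  open Poset P renaming (Carrier to C; refl to ≤-refl; trans to ≤-trans)
  open PosetNotions P
  open ListCounting Eq.setoid
  open IntegerSums using (∑<; sgn; sgn-double)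
  open EulerArithmetic using (factorialWith; euler-length-two; module EvenLengthStep)
  open GroupedSums using (sumℤ-grouped)

  ρ-cong : ∀ {x y} → x ≈ y → ρ x ≡ ρ y
  ρ-cong = proj₁ (proj₂ rank) _ _

  ρ-⋖ : ∀ {x y} → x ⋖ y → ρ y ≡ suc (ρ x)
  ρ-⋖ = proj₂ (proj₂ rank) _ _

  InInterval : C → C → C → Set ℓ₂
  InInterval x y w = x ≤ w × w ≤ y

  interval : C → C → List C
  interval x y = proj₁ (finite x y)

  #interval : C → C → ℕ
  #interval x y = length (interval x y)

  interval-enumerates : ∀ x y → IsEnumeration (InInterval x y) (interval x y)
  interval-enumerates x y =
    let (inside , complete , unique) = proj₂ (finite x y) in inside , unique , λ w (x≤w , w≤y) → complete w x≤w w≤y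

  ∈-interval⁺ : ∀ {x y w} → x ≤ w → w ≤ y → w ∈ interval x y
  ∈-interval⁺ x≤w w≤y = proj₂ (proj₂ (interval-enumerates _ _)) _ (x≤w , w≤y)

  ∈-interval⁻ : ∀ {x y w} → w ∈ interval x y → InInterval x y w
  ∈-interval⁻ = All.lookupₛ Eq.setoid (λ w≈v (x≤w , w≤y) → ≤-respʳ-≈ w≈v x≤w , ≤-respˡ-≈ w≈v w≤y)
                  (proj₁ (interval-enumerates _ _))

  _≤?_ : Decidable _≤_
  x ≤? y = map′ (proj₂ ∘ ∈-interval⁻) (∈-interval⁺ (bottom x)) (Any.any? (x ≈?_) (interval z y))

  _<?_ : Decidable _<_
  x <? y = (x ≤? y) ×-dec ¬? (x ≈? y)

  subinterval-shorter : ∀ {x y x′ y′ w} → x ≤ x′ → y′ ≤ y → InInterval x y w → ¬ InInterval x′ y′ w →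
                        #interval x′ y′ ℕ.< #interval x y
  subinterval-shorter x≤x′ y′≤y (x≤w , w≤y) w∉[x′,y′] =
    length-mono-< (proj₁ (proj₂ (interval-enumerates _ _)))
      (All.map (λ (x′≤v , v≤y′) → ∈-interval⁺ (≤-trans x≤x′ x′≤v) (≤-trans v≤y′ y′≤y))
               (proj₁ (interval-enumerates _ _)))
      (∈-interval⁺ x≤w w≤y) (w∉[x′,y′] ∘ ∈-interval⁻)

  ⋖-respˡ-≈ : ∀ {x x′ y} → x ≈ x′ → x ⋖ y → x′ ⋖ y
  ⋖-respˡ-≈ x≈x′ (x<y , nothing-between) =
    <-respˡ-≈ x≈x′ x<y , λ (v , x′<v , v<y) → nothing-between (v , <-respˡ-≈ (Eq.sym x≈x′) x′<v , v<y)

  ⋖-respʳ-≈ : ∀ {x y y′} → y ≈ y′ → x ⋖ y → x ⋖ y′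
  ⋖-respʳ-≈ y≈y′ (x<y , nothing-between) =
    <-respʳ-≈ y≈y′ x<y , λ (v , x<v , v<y′) → nothing-between (v , x<v , <-respʳ-≈ (Eq.sym y≈y′) v<y′)

  CoverPath-respˡ-≈ : ∀ {x x′ y} zs → x ≈ x′ → CoverPath x y zs → CoverPath x′ y zs
  CoverPath-respˡ-≈ []      x≈x′ (lift x≈y)   = lift (Eq.trans (Eq.sym x≈x′) x≈y)
  CoverPath-respˡ-≈ (_ ∷ _) x≈x′ (x⋖w , path) = ⋖-respˡ-≈ x≈x′ x⋖w , path

  CoverPath-++ : ∀ {x v y} zs {ws} → CoverPath x v zs → CoverPath v y ws → CoverPath x y (zs ++ ws)
  CoverPath-++ []       (lift x≈v)   path′ = CoverPath-respˡ-≈ _ (Eq.sym x≈v) path′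
  CoverPath-++ (_ ∷ zs) (x⋖w , path) path′ = x⋖w , CoverPath-++ zs path path′

  CoverPath-ρ : ∀ {x y} zs → CoverPath x y zs → ρ y ≡ ρ x + length zs
  CoverPath-ρ []       (lift x≈y)   = ≡.trans (≡.sym (ρ-cong x≈y)) (≡.sym (ℕ.+-identityʳ _))
  CoverPath-ρ (_ ∷ zs) (x⋖w , path) =
    ≡.trans (CoverPath-ρ zs path) (≡.trans (≡.cong (_+ length zs) (ρ-⋖ x⋖w)) (≡.sym (ℕ.+-suc _ _)))

  CoverPath-≤ : ∀ {x y} zs → CoverPath x y zs → x ≤ y
  CoverPath-≤ []       (lift x≈y)   = reflexive x≈y
  CoverPath-≤ (_ ∷ zs) (x⋖w , path) = ≤-trans (proj₁ (proj₁ x⋖w)) (CoverPath-≤ zs path)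

  -- Split [x, y] at an element strictly inside it; if there is none, x ⋖ y.
  coverPath : ∀ {x y} → x ≤ y → ∃ (CoverPath x y)
  coverPath {x} {y} x≤y = go x≤y (<-wellFounded (#interval x y))
    where
    go : ∀ {x y} → x ≤ y → Acc ℕ._<_ (#interval x y) → ∃ (CoverPath x y)
    go {x} {y} x≤y (acc shorter) with x ≈? y
    ... | yes x≈y = [] , lift x≈y
    ... | no  x≉y with Any.any? (λ v → (x <? v) ×-dec (v <? y)) (interval x y)
    ...   | no  nothing-inside = y ∷ [] , ((x≤y , x≉y) , nothing-between) , lift Eq.refl
      where
      nothing-between : ¬ (∃[ v ] (x < v × v < y))
      nothing-between (v , x<v , v<y) = nothing-inside
        (Any.map (λ v≈u → <-respʳ-≈ v≈u x<v , <-respˡ-≈ v≈u v<y) (∈-interval⁺ (proj₁ x<v) (proj₁ v<y)))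
    ...   | yes inside with Any.satisfied inside
    ...     | v , (x≤v , x≉v) , (v≤y , v≉y)
            with go x≤v (shorter (subinterval-shorter ≤-refl v≤y (x≤y , ≤-refl) (λ (_ , y≤v) → v≉y (antisym v≤y y≤v))))
               | go v≤y (shorter (subinterval-shorter x≤v ≤-refl (≤-refl , x≤y) (λ (v≤x , _) → x≉v (antisym x≤v v≤x))))
    ...     | zs , path | ws , path′ = zs ++ ws , CoverPath-++ zs path path′

  ρ-mono : ∀ {x y} → x ≤ y → ρ x ℕ.≤ ρ y
  ρ-mono x≤y with coverPath x≤y
  ... | zs , path = ≡.subst (ρ _ ℕ.≤_) (≡.sym (CoverPath-ρ zs path)) (ℕ.m≤m+n _ _)

  ρ-mono-< : ∀ {x y} → x < y → ρ x ℕ.< ρ y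
  ρ-mono-< (x≤y , x≉y) with coverPath x≤y
  ... | []     , lift x≈y = ⊥-elim (x≉y x≈y)
  ... | w ∷ ws , path     = ≡.subst (ρ _ ℕ.<_) (≡.sym (CoverPath-ρ (w ∷ ws) path)) (ℕ.m<m+n _ (s≤s z≤n))

  cover-below : ∀ {x y} → x < y → ∃[ w ] (x ⋖ w × w ≤ y)
  cover-below (x≤y , x≉y) with coverPath x≤y
  ... | []     , lift x≈y    = ⊥-elim (x≉y x≈y)
  ... | w ∷ ws , x⋖w , path = w , x⋖w , CoverPath-≤ ws path

  ρ-injective : ∀ {x y} → x ≤ y → ρ x ≡ ρ y → x ≈ y
  ρ-injective {x} {y} x≤y ρx≡ρy with x ≈? y
  ... | yes x≈y = x≈y
  ... | no  x≉y = ⊥-elim (ℕ.<-irrefl ρx≡ρy (ρ-mono-< (x≤y , x≉y)))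

  ρ-suc⇒⋖ : ∀ {x y} → x ≤ y → ρ y ≡ suc (ρ x) → x ⋖ y
  ρ-suc⇒⋖ x≤y ρy≡ =
    (x≤y , λ x≈y → ℕ.1+n≢n (≡.sym (≡.trans (ρ-cong x≈y) ρy≡))) ,
    λ (v , x<v , v<y) → ℕ.<-irrefl ≡.refl (ℕ.≤-trans (s≤s (ρ-mono-< x<v)) (≡.subst (ρ v ℕ.<_) ρy≡ (ρ-mono-< v<y)))

  Interval : ℕ → C → C → Set ℓ₂
  Interval n x y = x ≤ y × ρ y ≡ ρ x + n

  Interval-suc⇒≉ : ∀ {m x y} → Interval (suc m) x y → ¬ x ≈ y
  Interval-suc⇒≉ {m} {x} (_ , ρy≡) x≈y = ℕ.m+1+n≢m (ρ x) (≡.sym (≡.trans (ρ-cong x≈y) ρy≡))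

  element-of-rank : ∀ i {x y} → x ≤ y → ρ x + i ℕ.≤ ρ y → ∃[ w ] (x ≤ w × w ≤ y × ρ w ≡ ρ x + i)
  element-of-rank zero    {x} x≤y _ = x , ≤-refl , x≤y , ≡.sym (ℕ.+-identityʳ _)
  element-of-rank (suc i) {x} {y} x≤y ρx+i<ρy
    with element-of-rank i x≤y (ℕ.≤-trans (ℕ.+-monoʳ-≤ (ρ x) (ℕ.n≤1+n i)) ρx+i<ρy)
  ... | w , x≤w , w≤y , ρw≡ with cover-below (w≤y , λ w≈y → ℕ.<-irrefl (ρ-cong w≈y) ρw<ρy)
    where
    ρw<ρy : ρ w ℕ.< ρ y
    ρw<ρy = ℕ.<-≤-trans (≡.subst (ℕ._< ρ x + suc i) (≡.sym ρw≡) (ℕ.+-monoʳ-< (ρ x) (ℕ.n<1+n i))) ρx+i<ρy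
  ... | v , w⋖v , v≤y =
    v , ≤-trans x≤w (proj₁ (proj₁ w⋖v)) , v≤y ,
    ≡.trans (ρ-⋖ w⋖v) (≡.trans (≡.cong suc ρw≡) (≡.sym (ℕ.+-suc _ i)))

  interval-of-length : HasInfiniteChain → ∀ n → ∃₂ (Interval n)
  interval-of-length (f , f<f) n with rising n
    where
    rising : ∀ n → f 0 ≤ f n × ρ (f 0) + n ℕ.≤ ρ (f n)
    rising zero    = ≤-refl , ℕ.≤-reflexive (ℕ.+-identityʳ _)
    rising (suc n) with rising n
    ... | f0≤fn , ρ≤ = ≤-trans f0≤fn (proj₁ (f<f n)) ,
                       ℕ.≤-trans (ℕ.≤-reflexive (ℕ.+-suc _ n)) (ℕ.≤-trans (s≤s ρ≤) (ρ-mono-< (f<f n)))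
  ... | f0≤fn , ρ≤ with element-of-rank n f0≤fn ρ≤
  ...   | w , f0≤w , _ , ρw≡ = f 0 , w , f0≤w , ρw≡

  InLevel : C → C → ℕ → C → Set ℓ₂
  InLevel x y i w = InInterval x y w × ρ w ≡ ρ x + i

  InLevel-resp-≈ : ∀ {x y i w w′} → w ≈ w′ → InLevel x y i w → InLevel x y i w′
  InLevel-resp-≈ w≈w′ ((x≤w , w≤y) , ρw≡) =
    (≤-respʳ-≈ w≈w′ x≤w , ≤-respˡ-≈ w≈w′ w≤y) , ≡.trans (≡.sym (ρ-cong w≈w′)) ρw≡

  -- Filtering on ρ w ∸ ρ x, rather than on ρ w ≡ ρ x + i, makes the levels exactly the classes
  -- in which the Eulerian sum, weighted by (-1)^(ρ w ∸ ρ x), is grouped.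
  level : C → C → ℕ → List C
  level x y i = filter (λ w → ρ w ∸ ρ x ≟ i) (interval x y)

  #level : C → C → ℕ → ℕ
  #level x y i = length (level x y i)

  #atoms : C → C → ℕ
  #atoms x y = #level x y 1

  level-enumerates : ∀ x y i → IsEnumeration (InLevel x y i) (level x y i)
  level-enumerates x y i = enumeration-⇔
    (λ ((x≤w , w≤y) , ρw∸ρx≡i) →
       (x≤w , w≤y) , ≡.trans (≡.sym (ℕ.m+[n∸m]≡n (ρ-mono x≤w))) (≡.cong (ρ x +_) ρw∸ρx≡i))
    (λ (w∈[x,y] , ρw≡) → w∈[x,y] , ≡.trans (≡.cong (_∸ ρ x) ρw≡) (ℕ.m+n∸m≡n (ρ x) i))
    (filter-enumeration (λ w → ρ w ∸ ρ x ≟ i) (λ w≈w′ → ≡.trans (≡.cong (_∸ ρ x) (≡.sym (ρ-cong w≈w′))))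
      (interval-enumerates x y))

  ∈-level⁺ : ∀ {x y i w} → InLevel x y i w → w ∈ level x y i
  ∈-level⁺ = proj₂ (proj₂ (level-enumerates _ _ _)) _

  ∈-level⁻ : ∀ {x y i w} → w ∈ level x y i → InLevel x y i w
  ∈-level⁻ = All.lookupₛ Eq.setoid InLevel-resp-≈ (proj₁ (level-enumerates _ _ _))

  InLevel-1⇒⋖ : ∀ {x y a} → InLevel x y 1 a → x ⋖ a
  InLevel-1⇒⋖ {x} ((x≤a , _) , ρa≡) = ρ-suc⇒⋖ x≤a (≡.trans ρa≡ (ℕ.+-comm (ρ x) 1))

  ⋖⇒InLevel-1 : ∀ {x y a} → x ⋖ a → a ≤ y → InLevel x y 1 a
  ⋖⇒InLevel-1 {x} x⋖a a≤y = (proj₁ (proj₁ x⋖a) , a≤y) , ≡.trans (ρ-⋖ x⋖a) (ℕ.+-comm 1 (ρ x))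

  #level-0 : ∀ {x y} → x ≤ y → #level x y 0 ≡ 1
  #level-0 {x} x≤y = singleton-enumeration-length InLevel-resp-≈ ((≤-refl , x≤y) , ≡.sym (ℕ.+-identityʳ _))
    (λ ((x≤w , _) , ρw≡) → Eq.sym (ρ-injective x≤w (≡.sym (≡.trans ρw≡ (ℕ.+-identityʳ _)))))
    (level-enumerates x _ 0)

  #level-top : ∀ {n x y} → Interval n x y → #level x y n ≡ 1
  #level-top {n} {x} {y} (x≤y , ρy≡) = singleton-enumeration-length InLevel-resp-≈ ((x≤y , ≤-refl) , ρy≡)
    (λ ((_ , w≤y) , ρw≡) → ρ-injective w≤y (≡.trans ρw≡ (≡.sym ρy≡)))
    (level-enumerates x y n)

  #atoms-0 : ∀ {x y} → Interval 0 x y → #atoms x y ≡ 0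
  #atoms-0 {x} {y} (_ , ρy≡) = no-atoms (proj₁ (level-enumerates x y 1))
    where
    no-atoms : ∀ {ws} → All (InLevel x y 1) ws → length ws ≡ 0
    no-atoms []                      = ≡.refl
    no-atoms (((_ , w≤y) , ρw≡) ∷ _) with ℕ.+-cancelˡ-≤ (ρ x) 1 0 (≡.subst₂ ℕ._≤_ ρw≡ ρy≡ (ρ-mono w≤y))
    ... | ()

  Interval-below : ∀ {i x y w} → InLevel x y i w → Interval i x w
  Interval-below ((x≤w , _) , ρw≡) = x≤w , ρw≡

  Interval-above-atom : ∀ {m x y a} → Interval (suc m) x y → InLevel x y 1 a → Interval m a y
  Interval-above-atom {m} {x} (_ , ρy≡) ((_ , a≤y) , ρa≡) =
    a≤y , ≡.trans ρy≡ (≡.trans (≡.sym (ℕ.+-assoc (ρ x) 1 m)) (≡.cong (_+ m) (≡.sym ρa≡)))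

  module Binomial (binomial : IsBinomial ρ) where

    module Chains = ListCounting (Pointwise.setoid Eq.setoid)

    B : ℕ → ℕ
    B = proj₁ (proj₂ binomial)

    maximal-chains : ∀ {n x y} → Interval n x y → HasCard (Pointwise _≈_) (IsMaximalChain x y) (B n)
    maximal-chains (x≤y , ρy≡) = proj₂ (proj₂ binomial) _ _ _ x≤y ρy≡

    some-interval : ∀ n → ∃₂ (Interval n)
    some-interval = interval-of-length (proj₁ binomial)

    B-positive : ∀ n → 0 ℕ.< B n
    B-positive n with some-interval n
    ... | x , y , I with coverPath (proj₁ I) | maximal-chains I
    ...   | zs , path | _ , length≡B , _ , _ , complete =
      ≡.subst (0 ℕ.<_) length≡B (Membershipₚ.∈-length (Pointwise.setoid Eq.setoid) (complete (x ∷ zs) (Eq.refl , path)))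

    FirstStepTo : C → List C → Set ℓ₁
    FirstStepTo a (_ ∷ b ∷ _) = a ≈ b
    FirstStepTo a _           = Lift ℓ₁ ⊥

    first-step-to? : ∀ a chain → Dec (FirstStepTo a chain)
    first-step-to? a []          = no lower
    first-step-to? a (_ ∷ [])    = no lower
    first-step-to? a (_ ∷ b ∷ _) = a ≈? b

    FirstStepTo-respˡ : ∀ {chain a a′} → a ≈ a′ → FirstStepTo a chain → FirstStepTo a′ chain
    FirstStepTo-respˡ {_ ∷ _ ∷ _} a≈a′ a≈b = Eq.trans (Eq.sym a≈a′) a≈b

    FirstStepTo-respʳ : ∀ {a chain chain′} → Pointwise _≈_ chain chain′ → FirstStepTo a chain → FirstStepTo a chain′
    FirstStepTo-respʳ (_ ∷ b≈b′ ∷ _) a≈b = Eq.trans a≈b b≈b′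

    first-step-unique : ∀ {m x y chain} → Interval (suc m) x y → IsMaximalChain x y chain →
                        length (filter (λ a → first-step-to? a chain) (level x y 1)) ≡ 1
    first-step-unique {chain = _ ∷ []}      I (x≈x′ , lift x′≈y)    = ⊥-elim (Interval-suc⇒≉ I (Eq.trans x≈x′ x′≈y))
    first-step-unique {chain = x′ ∷ b ∷ zs} I (x≈x′ , x′⋖b , path) = singleton-enumeration-length
      (λ a≈a′ (a-atom , a≈b) → InLevel-resp-≈ a≈a′ a-atom , Eq.trans (Eq.sym a≈a′) a≈b)
      (⋖⇒InLevel-1 (⋖-respˡ-≈ (Eq.sym x≈x′) x′⋖b) (CoverPath-≤ zs path) , Eq.refl)
      proj₂
      (filter-enumeration (λ a → first-step-to? a (x′ ∷ b ∷ zs)) (FirstStepTo-respˡ {x′ ∷ b ∷ zs}) (level-enumerates _ _ 1))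

    #chains-through-atom : ∀ {m x y a chains} → Interval (suc m) x y → Chains.IsEnumeration (IsMaximalChain x y) chains →
                           InLevel x y 1 a → length (filter (first-step-to? a) chains) ≡ B m
    #chains-through-atom {m} {x} {y} {a} I chains-enumerate a-atom with maximal-chains (Interval-above-atom I a-atom)
    ... | chainsₐ , length≡B , maximalₐ , chainsₐ! , completeₐ = ≡.trans
      (Chains.enumeration-length (λ p → p) (λ p → p)
        (Chains.filter-enumeration (first-step-to? a) FirstStepTo-respʳ chains-enumerate)
        (All.map⁺ (All.map prepend maximalₐ) ,
         Uniqueₚ.map⁺ (Pointwise.setoid Eq.setoid) (Pointwise.setoid Eq.setoid) (λ { (_ ∷ eq) → eq }) chainsₐ! ,
         drop-x))
      (≡.trans (length-map (x ∷_) chainsₐ) length≡B)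
      where
      prepend : ∀ {chain} → IsMaximalChain a y chain → IsMaximalChain x y (x ∷ chain) × FirstStepTo a (x ∷ chain)
      prepend {_ ∷ _} (a≈b , path) = (Eq.refl , ⋖-respʳ-≈ a≈b (InLevel-1⇒⋖ a-atom) , path) , a≈b
      drop-x : ∀ chain → IsMaximalChain x y chain × FirstStepTo a chain → Chains._∈_ chain (map (x ∷_) chainsₐ)
      drop-x (_ ∷ b ∷ zs) ((x≈x′ , _ , path) , a≈b) =
        Anyₚ.map⁺ (Any.map (Eq.sym x≈x′ ∷_) (completeₐ (b ∷ zs) (a≈b , path)))

    -- Count the maximal chains of [x, y] by the atom they pass through.
    #atoms*B≡B : ∀ {m x y} → Interval (suc m) x y → #atoms x y * B m ≡ B (suc m)
    #atoms*B≡B {m} {x} {y} I with maximal-chains I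
    ... | chains , length≡B , maximal , chains! , complete = begin
      #atoms x y * B m       ≡⟨ DoubleCounting.double-count-regular first-step-to?
                                  (All.map (first-step-unique I) maximal)
                                  (All.map (≡.trans (ℕ.*-identityʳ _) ∘ #chains-through-atom I (maximal , chains! , complete))
                                           (proj₁ (level-enumerates x y 1))) ⟨
      length chains * 1 * 1  ≡⟨ ≡.trans (ℕ.*-identityʳ _) (ℕ.*-identityʳ _) ⟩
      length chains          ≡⟨ length≡B ⟩
      B (suc m)              ∎
      where open ≡.≡-Reasoning

    A : ℕ → ℕ
    A zero    = 0
    A (suc m) = let (x , y , _) = some-interval (suc m) in #atoms x y

    #atoms≡A : ∀ {n x y} → Interval n x y → #atoms x y ≡ A n
    #atoms≡A {zero}  I = #atoms-0 I
    #atoms≡A {suc m} I = ℕ.*-cancelʳ-≡ _ _ (B m) {{ℕ.>-nonZero (B-positive m)}}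
      (≡.trans (#atoms*B≡B I) (≡.sym (#atoms*B≡B (proj₂ (proj₂ (some-interval (suc m)))))))

    A[1]≡1 : A 1 ≡ 1
    A[1]≡1 = let (_ , _ , I) = some-interval 1 in ≡.trans (≡.sym (#atoms≡A I)) (#level-top I)

    A-positive : ∀ m → 0 ℕ.< A (suc m)
    A-positive m with some-interval (suc m)
    ... | x , y , I with cover-below (proj₁ I , Interval-suc⇒≉ I)
    ...   | a , x⋖a , a≤y =
      ≡.subst (0 ℕ.<_) (#atoms≡A I) (Membershipₚ.∈-length Eq.setoid (∈-level⁺ (⋖⇒InLevel-1 x⋖a a≤y)))

    -- Double count the pairs (a, w) with a an atom of [x, y], w of rank j + 1 in [x, y] and a ≤ w.
    #level-suc : ∀ {m x y} j {d e} → Interval (suc m) x y →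
                 (∀ {a} → InLevel x y 1 a → #level a y j * d ≡ e) →
                 #level x y (suc j) * A (suc j) * d ≡ A (suc m) * e
    #level-suc {m} {x} {y} j {d} {e} I above-atom = ≡.trans
      (DoubleCounting.double-count-regular _≤?_
        (All.map atoms-below (proj₁ (level-enumerates x y (suc j))))
        (All.map (λ a-atom → ≡.trans (≡.cong (_* d) (level-above a-atom)) (above-atom a-atom)) (proj₁ (level-enumerates x y 1))))
      (≡.cong (_* e) (#atoms≡A I))
      where
      atoms-below : ∀ {w} → InLevel x y (suc j) w → length (filter (_≤? w) (level x y 1)) ≡ A (suc j)
      atoms-below {w} w∈ = ≡.trans
        (enumeration-length (λ (((x≤a , _) , ρa≡) , a≤w) → (x≤a , a≤w) , ρa≡)
                            (λ ((x≤a , a≤w) , ρa≡) → ((x≤a , ≤-trans a≤w (proj₂ (proj₁ w∈))) , ρa≡) , a≤w)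
                            (filter-enumeration (_≤? w) (λ a≈a′ → ≤-respˡ-≈ a≈a′) (level-enumerates x y 1))
                            (level-enumerates x w 1))
        (#atoms≡A (Interval-below w∈))
      level-above : ∀ {a} → InLevel x y 1 a → length (filter (a ≤?_) (level x y (suc j))) ≡ #level a y j
      level-above {a} ((x≤a , _) , ρa≡) = enumeration-length
        (λ (((_ , w≤y) , ρw≡) , a≤w) →
           (a≤w , w≤y) , ≡.trans ρw≡ (≡.trans (≡.sym (ℕ.+-assoc (ρ x) 1 j)) (≡.cong (_+ j) (≡.sym ρa≡))))
        (λ ((a≤w , w≤y) , ρw≡) →
           ((≤-trans x≤a a≤w , w≤y) , ≡.trans ρw≡ (≡.trans (≡.cong (_+ j) ρa≡) (ℕ.+-assoc (ρ x) 1 j))) , a≤w)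
        (filter-enumeration (a ≤?_) (λ w≈w′ → ≤-respʳ-≈ w≈w′) (level-enumerates x y (suc j)))
        (level-enumerates a y j)

    F : ℕ → ℕ
    F = factorialWith A

    #level*F*F≡F : ∀ {n x y} i → Interval n x y → i ℕ.≤ n → #level x y i * (F i * F (n ∸ i)) ≡ F n
    #level*F*F≡F {n} zero I _ =
      ≡.trans (≡.cong (_* (1 * F n)) (#level-0 (proj₁ I))) (≡.trans (ℕ.*-identityˡ _) (ℕ.*-identityˡ _))
    #level*F*F≡F {suc m} {x} {y} (suc j) I (s≤s j≤m) = begin
      #level x y (suc j) * (A (suc j) * F j * F (m ∸ j))
        ≡⟨ reassociate (#level x y (suc j)) (A (suc j)) (F j) (F (m ∸ j)) ⟩
      #level x y (suc j) * A (suc j) * (F j * F (m ∸ j))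
        ≡⟨ #level-suc j I (λ a-atom → #level*F*F≡F j (Interval-above-atom I a-atom) j≤m) ⟩
      A (suc m) * F m ∎
      where
      open ≡.≡-Reasoning
      reassociate : ∀ l a f g → l * (a * f * g) ≡ l * a * (f * g)
      reassociate = solve-∀

    module Eulerian (eulerian : IsEulerian ρ) where

      ∑sgn#level≡0 : ∀ {n x y} → Interval (suc n) x y → ∑[ k < suc (suc n) ] (sgn k ℤ.* ℤ.+_ (#level x y k)) ≡ 0ℤ
      ∑sgn#level≡0 {n} {x} {y} I@(x≤y , ρy≡) =
        ≡.trans (≡.sym (sumℤ-grouped (λ w → ρ w ∸ ρ x) sgn _ (interval x y) ranks-bounded))
                (proj₂ eulerian x y (x≤y , Interval-suc⇒≉ I) (interval x y) (proj₂ (finite x y)))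
        where
        ranks-bounded : All (λ w → ρ w ∸ ρ x ℕ.< suc (suc n)) (interval x y)
        ranks-bounded = All.map (λ (_ , w≤y) → s≤s (ℕ.≤-trans (ℕ.∸-monoˡ-≤ (ρ x) (ρ-mono w≤y))
                                   (ℕ.≤-reflexive (≡.trans (≡.cong (_∸ ρ x) ρy≡) (ℕ.m+n∸m≡n (ρ x) (suc n))))))
                                (proj₁ (interval-enumerates x y))

      A[2]≡2 : A 2 ≡ 2
      A[2]≡2 = let (x , y , I) = some-interval 2 in
        ≡.trans (≡.sym (#atoms≡A I)) (euler-length-two (#level x y) (#level-0 (proj₁ I)) (#level-top I) (∑sgn#level≡0 I))

      A≡id-step : ∀ t → let p = suc (suc (t + t)) in
        (∀ {k} → k ℕ.≤ p → A k ≡ k) → p ℕ.< A (suc p) → A (suc p) ≡ suc p × A (suc (suc p)) ≡ suc (suc p)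
      A≡id-step t A≗id p<α = let (x , y , I) = some-interval (suc (suc (suc (suc (t + t))))) in
        EvenLengthStep.α≡1+p×β≡n (t + t) (sgn-double t) A (#level x y) A≗id p<α (A-positive _)
          (λ {i} → #level*F*F≡F i I) (∑sgn#level≡0 I)

module GradedLattice {c ℓ₁ ℓ₂} (P : Poset c ℓ₁ ℓ₂)
  (finite : PosetNotions.LocallyFinite P) (lattice : PosetNotions.IsLattice P)
  (z : Poset.Carrier P) (bottom : PosetNotions.IsBottom P z)
  (ρ : Poset.Carrier P → ℕ) (rank : PosetNotions.IsRankFunction P z ρ) where

  open import Level using (lift)
  open import Data.Nat as ℕ using (zero; suc; _+_; z≤n; s≤s)
  import Data.Nat.Properties as ℕ
  open import Data.List using (List; []; _∷_; length)
  open import Data.List.Relation.Unary.All as All using (All; []; _∷_)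
  import Data.List.Relation.Unary.All.Properties as Allₚ
  open import Data.List.Relation.Unary.AllPairs using ([]; _∷_)
  open import Data.List.Relation.Unary.Any using (Any; here; there)
  import Data.List.Relation.Unary.Any.Properties as Anyₚ
  open import Data.Product using (∃-syntax; _×_; _,_; proj₁; proj₂)
  open import Data.Empty using (⊥-elim)
  open import Function using (_∘_)
  open import Relation.Nullary using (¬_; yes; no)
  open import Relation.Binary.Lattice using (Lattice)
  open import Relation.Binary.PropositionalEquality as ≡ using (_≡_)

  open Poset P renaming (Carrier to C; refl to ≤-refl; trans to ≤-trans)
  open PosetNotions P
  open ListCounting Eq.setoid

  latticeBundle : Lattice c ℓ₁ ℓ₂
  latticeBundle = record
    { _∨_       = proj₁ lattice
    ; _∧_       = proj₁ (proj₂ lattice)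
    ; isLattice = record
      { isPartialOrder = isPartialOrder
      ; supremum       = proj₁ (proj₂ (proj₂ lattice))
      ; infimum        = proj₂ (proj₂ (proj₂ lattice))
      }
    }

  open Lattice latticeBundle using (_∨_; _∧_; x≤x∨y; y≤x∨y; ∨-least; x∧y≤x; x∧y≤y; ∧-greatest)
  open import Relation.Binary.Lattice.Properties.JoinSemilattice (Lattice.joinSemilattice latticeBundle)
    using (∨-cong; ∨-comm; ∨-monotonic; x≤y⇒x∨y≈y)

  private
    ∨≤∧⇒≈ : ∀ {x y} → x ∨ y ≤ x ∧ y → x ≈ y
    ∨≤∧⇒≈ {x} {y} ∨≤∧ = antisym (≤-trans (≤-trans (x≤x∨y x y) ∨≤∧) (x∧y≤y x y))
                                (≤-trans (≤-trans (y≤x∨y x y) ∨≤∧) (x∧y≤x x y))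

    ≈⇒∨≤∧ : ∀ {x y} → x ≈ y → x ∨ y ≤ x ∧ y
    ≈⇒∨≤∧ x≈y = ∨-least (∧-greatest ≤-refl (reflexive x≈y)) (∧-greatest (reflexive (Eq.sym x≈y)) ≤-refl)

  -- x ≈ y exactly when the interval [x ∧ y, x ∨ y] is a single point.
  _≈?_ : ∀ x y → Dec (x ≈ y)
  x ≈? y with finite (x ∧ y) (x ∨ y)
  ... | [] , _ , complete , _ with complete (x ∧ y) ≤-refl (≤-trans (x∧y≤x x y) (x≤x∨y x y))
  ...   | ()
  x ≈? y | _ ∷ [] , _ , complete , _
    with complete (x ∧ y) ≤-refl (≤-trans (x∧y≤x x y) (x≤x∨y x y))
       | complete (x ∨ y) (≤-trans (x∧y≤x x y) (x≤x∨y x y)) ≤-refl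
  ... | here ∧≈w | here ∨≈w = yes (∨≤∧⇒≈ (reflexive (Eq.trans ∨≈w (Eq.sym ∧≈w))))
  x ≈? y | u ∷ v ∷ _ , (∧≤u , u≤∨) ∷ (∧≤v , v≤∨) ∷ _ , _ , (u≉v ∷ _) ∷ _ =
    no λ x≈y → u≉v (antisym (≤-trans u≤∨ (≤-trans (≈⇒∨≤∧ x≈y) ∧≤v))
                            (≤-trans v≤∨ (≤-trans (≈⇒∨≤∧ x≈y) ∧≤u)))

  open GradedPoset P finite _≈?_ z bottom ρ rank

  <∨-of-distinct-covers : ∀ {x a o} → x ⋖ a → x ⋖ o → ¬ o ≈ a → a < (a ∨ o)
  <∨-of-distinct-covers x⋖a x⋖o o≉a =
    x≤x∨y _ _ , λ a≈a∨o → o≉a (ρ-injective (≤-trans (y≤x∨y _ _) (reflexive (Eq.sym a≈a∨o)))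
                                            (≡.trans (ρ-⋖ x⋖o) (≡.sym (ρ-⋖ x⋖a))))

  join-of-atoms : ∀ {x e a o} → Interval 2 x e → InLevel x e 1 a → InLevel x e 1 o → ¬ o ≈ a → a ∨ o ≈ e
  join-of-atoms {x} {e} {a} {o} (_ , ρe≡) a-atom o-atom o≉a =
    ρ-injective a∨o≤e (ℕ.≤-antisym (ρ-mono a∨o≤e)
      (≡.subst (ℕ._≤ ρ (a ∨ o)) 1+ρa≡ρe
        (ρ-mono-< (<∨-of-distinct-covers (InLevel-1⇒⋖ a-atom) (InLevel-1⇒⋖ o-atom) o≉a))))
    where
    a∨o≤e : a ∨ o ≤ e
    a∨o≤e = ∨-least (proj₂ (proj₁ a-atom)) (proj₂ (proj₁ o-atom))
    1+ρa≡ρe : suc (ρ a) ≡ ρ e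
    1+ρa≡ρe = ≡.trans (≡.cong suc (proj₂ a-atom))
                (≡.trans (≡.cong suc (ℕ.+-comm (ρ x) 1)) (≡.trans (ℕ.+-comm 2 (ρ x)) (≡.sym ρe≡)))

  -- partner injects the atoms of [a, y] into the atoms of [x, y] other than a, onto them when the counts agree.
  module TwoAtoms (#atoms≡2 : ∀ {x y} → Interval 2 x y → #atoms x y ≡ 2) {x y a} (a-atom : InLevel x y 1 a) where

    private
      [x,e]-length-2 : ∀ {e} → InLevel a y 1 e → Interval 2 x e
      [x,e]-length-2 ((a≤e , _) , ρe≡) =
        ≤-trans (proj₁ (proj₁ a-atom)) a≤e , ≡.trans ρe≡ (≡.trans (≡.cong (_+ 1) (proj₂ a-atom)) (ℕ.+-assoc (ρ x) 1 1))

    partner : ∀ {e} → InLevel a y 1 e → ∃[ o ] ((InLevel x y 1 o × ¬ o ≈ a) × a ∨ o ≈ e)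
    partner e-atom@((a≤e , e≤y) , _)
      with element-≉ _≈?_ (proj₁ (proj₂ (level-enumerates x _ 1))) (ℕ.≤-reflexive (≡.sym (#atoms≡2 ([x,e]-length-2 e-atom)))) a
    ... | o , o∈ , o≉a with ∈-level⁻ o∈
    ...   | o-atom@((x≤o , o≤e) , ρo≡) =
      o , (((x≤o , ≤-trans o≤e e≤y) , ρo≡) , o≉a) ,
      join-of-atoms ([x,e]-length-2 e-atom) ((proj₁ (proj₁ a-atom) , a≤e) , proj₂ a-atom) o-atom o≉a

    partners : ∀ {es} → All (InLevel a y 1) es → List C
    partners = All.reduce (proj₁ ∘ partner)

    partners-are-atoms : ∀ {es} (es-atoms : All (InLevel a y 1) es) →
                         All (λ o → InLevel x y 1 o × ¬ o ≈ a) (partners es-atoms)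
    partners-are-atoms []                  = []
    partners-are-atoms (e-atom ∷ es-atoms) = proj₁ (proj₂ (partner e-atom)) ∷ partners-are-atoms es-atoms

    length-partners : ∀ {es} (es-atoms : All (InLevel a y 1) es) → length (partners es-atoms) ≡ length es
    length-partners []             = ≡.refl
    length-partners (_ ∷ es-atoms) = ≡.cong suc (length-partners es-atoms)

    ∈-partners⁻ : ∀ {es b} (es-atoms : All (InLevel a y 1) es) → b ∈ partners es-atoms →
                  ∃[ e ] (InLevel a y 1 e × a ∨ b ≈ e)
    ∈-partners⁻ (e-atom ∷ _)   (here b≈o)  = _ , e-atom , Eq.trans (∨-cong Eq.refl b≈o) (proj₂ (proj₂ (partner e-atom)))
    ∈-partners⁻ (_ ∷ es-atoms) (there b∈) = ∈-partners⁻ es-atoms b∈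

    partners-unique : ∀ {es} (es-atoms : All (InLevel a y 1) es) → Unique es → Unique (partners es-atoms)
    partners-unique []                  []           = []
    partners-unique (e-atom ∷ es-atoms) (e≉es ∷ es!) = distinct es-atoms e≉es ∷ partners-unique es-atoms es!
      where
      distinct : ∀ {es} (es-atoms : All (InLevel a y 1) es) → All (λ e′ → ¬ _ ≈ e′) es →
                 All (λ o′ → ¬ proj₁ (partner e-atom) ≈ o′) (partners es-atoms)
      distinct []                   []            = []
      distinct (e′-atom ∷ es-atoms) (e≉e′ ∷ e≉es) =
        (λ o≈o′ → e≉e′ (Eq.trans (Eq.sym (proj₂ (proj₂ (partner e-atom))))
                         (Eq.trans (∨-cong Eq.refl o≈o′) (proj₂ (proj₂ (partner e′-atom)))))) ∷
        distinct es-atoms e≉es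

    private
      atoms-of-[a,y] : All (InLevel a y 1) (level a y 1)
      atoms-of-[a,y] = proj₁ (level-enumerates a y 1)

      a∷partners : List C
      a∷partners = a ∷ partners atoms-of-[a,y]

      a∷partners-unique : Unique a∷partners
      a∷partners-unique = All.map (λ (_ , o≉a) a≈o → o≉a (Eq.sym a≈o)) (partners-are-atoms atoms-of-[a,y])
                        ∷ partners-unique atoms-of-[a,y] (proj₁ (proj₂ (level-enumerates a y 1)))

      a∷partners⊑atoms : a∷partners ⊑ level x y 1
      a∷partners⊑atoms = ∈-level⁺ a-atom ∷ All.map (∈-level⁺ ∘ proj₁) (partners-are-atoms atoms-of-[a,y])

      length-a∷partners : length a∷partners ≡ suc (#atoms a y)
      length-a∷partners = ≡.cong suc (length-partners atoms-of-[a,y])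

    #atoms-above-atom : suc (#atoms a y) ℕ.≤ #atoms x y
    #atoms-above-atom = ≡.subst (ℕ._≤ #atoms x y) length-a∷partners (length-mono a∷partners-unique a∷partners⊑atoms)

    ⋖-join-atom : #atoms x y ≡ suc (#atoms a y) → ∀ {b} → InLevel x y 1 b → ¬ b ≈ a → a ⋖ (a ∨ b)
    ⋖-join-atom #atoms≡ b-atom b≉a
      with ∈-⊑ (∈-level⁺ b-atom) (⊑-complete _≈?_ a∷partners-unique a∷partners⊑atoms
                                   (ℕ.≤-reflexive (≡.trans #atoms≡ (≡.sym length-a∷partners))))
    ... | here  b≈a = ⊥-elim (b≉a b≈a)
    ... | there b∈  with ∈-partners⁻ atoms-of-[a,y] b∈
    ...   | e , e-atom , a∨b≈e = ⋖-respʳ-≈ (Eq.sym a∨b≈e) (InLevel-1⇒⋖ e-atom)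

  module BooleanAtoms (#atoms≡length : ∀ {n x y} → Interval n x y → #atoms x y ≡ n) where

    ⋖-join-of-covers : ∀ {x u v} → x ⋖ u → x ⋖ v → ¬ v ≈ u → u ⋖ (u ∨ v)
    ⋖-join-of-covers {x} {u} {v} x⋖u x⋖v v≉u
      with ℕ.m≤n⇒∃[o]m+o≡n (ρ-mono-< (<∨-of-distinct-covers x⋖u x⋖v v≉u))
    ... | k , ρ[u∨v]≡ = TwoAtoms.⋖-join-atom #atoms≡length u-atom
          (≡.trans (#atoms≡length I) (≡.cong suc (≡.sym (#atoms≡length (Interval-above-atom I u-atom)))))
          (⋖⇒InLevel-1 x⋖v (y≤x∨y u v)) v≉u
      where
      u-atom : InLevel x (u ∨ v) 1 u
      u-atom = ⋖⇒InLevel-1 x⋖u (x≤x∨y u v)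
      I : Interval (suc (suc k)) x (u ∨ v)
      I = ≤-trans (proj₁ (proj₁ x⋖u)) (x≤x∨y u v) ,
          ≡.trans (≡.sym ρ[u∨v]≡) (≡.trans (≡.cong (λ r → suc r + k) (ρ-⋖ x⋖u))
                                           (≡.sym (≡.trans (ℕ.+-suc (ρ x) (suc k)) (≡.cong suc (ℕ.+-suc (ρ x) k)))))

    ⋖-∨-atom : ∀ {a x} → z ⋖ a → ¬ a ≤ x → x ⋖ (x ∨ a)
    ⋖-∨-atom {a} {x} z⋖a a≰x =
      climb _ (proj₂ (coverPath (bottom x))) (⋖-respʳ-≈ (Eq.sym (x≤y⇒x∨y≈y (bottom a))) z⋖a)
      where
      climb : ∀ {w} vs → CoverPath w x vs → w ⋖ (w ∨ a) → x ⋖ (x ∨ a)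
      climb []           (lift w≈x)   w⋖w∨a = ⋖-respˡ-≈ w≈x (⋖-respʳ-≈ (∨-cong w≈x Eq.refl) w⋖w∨a)
      climb {w} (v ∷ vs) (w⋖v , path) w⋖w∨a = climb vs path (⋖-respʳ-≈ v∨[w∨a]≈v∨a
        (⋖-join-of-covers w⋖v w⋖w∨a
          (λ w∨a≈v → a≰x (≤-trans (≤-trans (y≤x∨y w a) (reflexive w∨a≈v)) (CoverPath-≤ vs path)))))
        where
        v∨[w∨a]≈v∨a : v ∨ (w ∨ a) ≈ v ∨ a
        v∨[w∨a]≈v∨a = antisym
          (∨-least (x≤x∨y v a) (∨-least (≤-trans (proj₁ (proj₁ w⋖v)) (x≤x∨y v a)) (y≤x∨y v a)))
                              (∨-monotonic ≤-refl (y≤x∨y w a))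

    atoms-below : C → FinSubset z
    atoms-below x = All.toList (All.map InLevel-1⇒⋖ (proj₁ (level-enumerates z x 1)))

    atoms-below⁺ : ∀ {u x} → z ⋖ u → u ≤ x → Any (λ b → u ≈ proj₁ b) (atoms-below x)
    atoms-below⁺ z⋖u u≤x =
      Anyₚ.map⁻ (≡.subst (Any (_ ≈_)) (≡.sym (map-proj₁-toList _)) (∈-level⁺ (⋖⇒InLevel-1 z⋖u u≤x)))

    atoms-below-≤ : ∀ x → All (λ b → proj₁ b ≤ x) (atoms-below x)
    atoms-below-≤ x = Allₚ.map⁻ (≡.subst (All (_≤ x)) (≡.sym (map-proj₁-toList _))
                                   (All.map (proj₂ ∘ proj₁) (proj₁ (level-enumerates z x 1))))

    ≤-of-∈ : ∀ {u y} {S : FinSubset z} → Any (λ b → u ≈ proj₁ b) S → All (λ b → proj₁ b ≤ y) S → u ≤ y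
    ≤-of-∈ (here u≈b)  (b≤y ∷ _) = ≤-respˡ-≈ (Eq.sym u≈b) b≤y
    ≤-of-∈ (there u∈S) (_ ∷ S≤y) = ≤-of-∈ u∈S S≤y

    join : FinSubset z → C
    join []      = z
    join (b ∷ S) = proj₁ b ∨ join S

    join-ub : ∀ S → All (λ b → proj₁ b ≤ join S) S
    join-ub []      = []
    join-ub (b ∷ S) = x≤x∨y _ _ ∷ All.map (λ b≤J → ≤-trans b≤J (y≤x∨y _ _)) (join-ub S)

    join-least : ∀ {y} S → All (λ b → proj₁ b ≤ y) S → join S ≤ y
    join-least []      []          = bottom _
    join-least (b ∷ S) (b≤y ∷ S≤y) = ∨-least b≤y (join-least S S≤y)

    #atoms-from-bottom : ∀ x → #atoms z x ≡ ρ x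
    #atoms-from-bottom x = #atoms≡length (bottom x , ≡.cong (_+ ρ x) (≡.sym (proj₁ rank)))

    -- If a ≰ J then J ⋖ J ∨ a, so a together with the atoms below J are all the atoms below a ∨ J.
    atoms-of-join : ∀ S {b} → z ⋖ b → b ≤ join S → Any (λ a → b ≈ proj₁ a) S
    atoms-of-join []      z⋖b b≤z    = ⊥-elim (proj₂ (proj₁ z⋖b) (antisym (bottom _) b≤z))
    atoms-of-join (a ∷ S) z⋖b b≤join with proj₁ a ≤? join S
    ... | yes a≤J = there (atoms-of-join S z⋖b (≤-trans b≤join (∨-least a≤J ≤-refl)))
    ... | no  a≰J with ∈-⊑ (∈-level⁺ (⋖⇒InLevel-1 z⋖b b≤join)) (⊑-complete _≈?_ a∷atoms-unique a∷atoms⊑ length≤)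
      where
      J : C
      J = join S
      a∷atoms-unique : Unique (proj₁ a ∷ level z J 1)
      a∷atoms-unique =
        All.map (λ w-atom a≈w → a≰J (≤-respˡ-≈ (Eq.sym a≈w) (proj₂ (proj₁ w-atom)))) (proj₁ (level-enumerates z J 1))
        ∷ proj₁ (proj₂ (level-enumerates z J 1))
      a∷atoms⊑ : proj₁ a ∷ level z J 1 ⊑ level z (proj₁ a ∨ J) 1
      a∷atoms⊑ =
        ∈-level⁺ (⋖⇒InLevel-1 (proj₂ a) (x≤x∨y _ _))
        ∷ All.map (λ ((z≤w , w≤J) , ρw≡) → ∈-level⁺ ((z≤w , ≤-trans w≤J (y≤x∨y _ _)) , ρw≡))
                  (proj₁ (level-enumerates z J 1))
      length≤ : #atoms z (proj₁ a ∨ J) ℕ.≤ suc (#atoms z J)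
      length≤ = ℕ.≤-reflexive (begin
        #atoms z (proj₁ a ∨ J) ≡⟨ #atoms-from-bottom _ ⟩
        ρ (proj₁ a ∨ J)        ≡⟨ ρ-cong (∨-comm _ _) ⟩
        ρ (J ∨ proj₁ a)        ≡⟨ ρ-⋖ (⋖-∨-atom (proj₂ a) a≰J) ⟩
        suc (ρ J)              ≡⟨ ≡.cong suc (#atoms-from-bottom J) ⟨
        suc (#atoms z J)       ∎)
        where open ≡.≡-Reasoning
    ...   | here  b≈a = here b≈a
    ...   | there b∈  = there (atoms-of-join S z⋖b (proj₂ (proj₁ (∈-level⁻ b∈))))

    atomistic : ∀ x → join (atoms-below x) ≈ x
    atomistic x = ρ-injective J≤x (ℕ.≤-antisym (ρ-mono J≤x) (begin
      ρ x         ≡⟨ #atoms-from-bottom x ⟨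
      #atoms z x  ≤⟨ length-mono (proj₁ (proj₂ (level-enumerates z x 1)))
                                  (All.map atom-below-J (proj₁ (level-enumerates z x 1))) ⟩
      #atoms z J  ≡⟨ #atoms-from-bottom J ⟩
      ρ J         ∎))
      where
      open ℕ.≤-Reasoning
      J : C
      J = join (atoms-below x)
      J≤x : J ≤ x
      J≤x = join-least _ (atoms-below-≤ x)
      atom-below-J : ∀ {u} → InLevel z x 1 u → u ∈ level z J 1
      atom-below-J u-atom@((z≤u , u≤x) , ρu≡) =
        ∈-level⁺ ((z≤u , ≤-of-∈ (atoms-below⁺ (InLevel-1⇒⋖ u-atom) u≤x) (join-ub _)) , ρu≡)

    atoms-below-mono : ∀ {x y} → x ≤ y → atoms-below x ⊆B atoms-below y
    atoms-below-mono {x} x≤y = All.map (λ {b} b≤x → atoms-below⁺ (proj₂ b) (≤-trans b≤x x≤y)) (atoms-below-≤ x)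

    atoms-below-reflects-⊆ : ∀ {x y} → atoms-below x ⊆B atoms-below y → x ≤ y
    atoms-below-reflects-⊆ {x} {y} fx⊆fy = ≤-respˡ-≈ (atomistic x)
      (join-least _ (All.map (λ b∈fy → ≤-of-∈ b∈fy (atoms-below-≤ y)) fx⊆fy))

    ≅𝔹-atoms : IsoToBooleanOfAtoms z
    ≅𝔹-atoms = atoms-below , record
      { isOrderMonomorphism = record
        { isOrderHomomorphism = record
          { cong = λ x≈y → atoms-below-mono (reflexive x≈y) , atoms-below-mono (reflexive (Eq.sym x≈y))
          ; mono = atoms-below-mono
          }
        ; injective = λ (fx⊆fy , fy⊆fx) → antisym (atoms-below-reflects-⊆ fx⊆fy) (atoms-below-reflects-⊆ fy⊆fx)
        ; cancel    = atoms-below-reflects-⊆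
        }
      ; surjective = λ S → join S , λ w≈J →
          All.map (λ {b} b≤w → atoms-of-join S (proj₂ b) (≤-respʳ-≈ w≈J b≤w)) (atoms-below-≤ _) ,
          All.map (λ {a} a≤J → atoms-below⁺ (proj₂ a) (≤-respʳ-≈ (Eq.sym w≈J) a≤J)) (join-ub S)
      }

  module EulerianBinomial (binomial : IsBinomial ρ) (eulerian : IsEulerian ρ) where

    open Binomial binomial
    open Eulerian eulerian
    open EulerArithmetic using (id-upto-suc)

    A-grows : ∀ m → suc (A m) ℕ.≤ A (suc m)
    A-grows m =
      let (x , y , I) = some-interval (suc m)
          (a , x⋖a , a≤y) = cover-below (proj₁ I , Interval-suc⇒≉ I)
          a-atom = ⋖⇒InLevel-1 x⋖a a≤y
      in ≡.subst₂ ℕ._≤_ (≡.cong suc (#atoms≡A (Interval-above-atom I a-atom))) (#atoms≡A I)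
           (TwoAtoms.#atoms-above-atom (λ I₂ → ≡.trans (#atoms≡A I₂) A[2]≡2) a-atom)

    A-lower : ∀ m → m ℕ.≤ A m
    A-lower zero    = z≤n
    A-lower (suc m) = ℕ.≤-trans (s≤s (A-lower m)) (A-grows m)

    -- The Eulerian relation says nothing at odd lengths, so A is pinned down two lengths at a time.
    A≡id-upto : ∀ t {k} → k ℕ.≤ suc (suc (t + t)) → A k ≡ k
    A≡id-upto zero = id-upto-suc {A} (id-upto-suc {A} (λ { z≤n → ≡.refl }) A[1]≡1) A[2]≡2
    A≡id-upto (suc t) {k} k≤ =
      id-upto-suc {A} (id-upto-suc {A} (A≡id-upto t) (proj₁ next-two)) (proj₂ next-two)
        (≡.subst (k ℕ.≤_) (≡.cong (suc ∘ suc ∘ suc) (ℕ.+-suc t t)) k≤)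
      where
      next-two : A (3 + (t + t)) ≡ 3 + (t + t) × A (4 + (t + t)) ≡ 4 + (t + t)
      next-two = A≡id-step t (A≡id-upto t) (A-lower _)

    #atoms≡length : ∀ {n x y} → Interval n x y → #atoms x y ≡ n
    #atoms≡length {n} I = ≡.trans (#atoms≡A I) (A≡id-upto n (ℕ.m≤n⇒m≤1+n (ℕ.m≤n⇒m≤1+n (ℕ.m≤m+n n n))))

theorem2p18 : ∀ {c ℓ₁ ℓ₂ : Level} (L : Poset c ℓ₁ ℓ₂) →
    PosetNotions.LocallyFinite L →
    (z : Poset.Carrier L) → PosetNotions.IsBottom L z →
    (ρ : Poset.Carrier L → ℕ) → PosetNotions.IsRankFunction L z ρ →
    PosetNotions.IsBinomial L ρ → PosetNotions.IsEulerian L ρ →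
    PosetNotions.IsLattice L →
    PosetNotions.IsoToBooleanOfAtoms L z
theorem2p18 L finite z bottom ρ rank binomial eulerian lattice =
  BooleanAtoms.≅𝔹-atoms (EulerianBinomial.#atoms≡length binomial eulerian)
  where open GradedLattice L finite lattice z bottom ρ rank
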